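{- There exists an orientable quadrangular embedding of a simple graph with $4$ vertices and $\binom{4}{2}-2=4$ edges. Moreover, for each even integer $n\ge 4$ and each integer $t$ with $0\le t\le n-4$ and $t \equiv \frac12 n(n-5) \pmod 4$, there exists an orientable quadrangular embedding of a simple graph with $n$ vertices and $\binom{n}{2}-t$ edges.
   Context: All graphs are simple. Embeddings are cellular embeddings in surfaces (connected compact 2-manifolds without boundary), i.e., every face is an open disc. An embedding is quadrangular if every face is bounded by a $4$-cycle; it is orientable if the surface is orientable. -}

module Defs where

open import Data.Nat using (ℕ; zero; suc; _+_; _*_; _<ᵇ_)
open import Data.Fin using (Fin; toℕ)
open import Data.Bool using (Bool; true; false; _∧_)
open import Data.List using (List; []; _∷_; map; concatMap)
open import Data.List.Base using (allFin)
open import Data.Product using (Σ; _×_; _,_; ∃)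
open import Relation.Binary.PropositionalEquality using (_≡_; _≢_)

record SimpleGraph (n : ℕ) : Set where
  field
    Adj   : Fin n → Fin n → Bool
    sym   : ∀ u v → Adj u v ≡ Adj v u
    irrefl : ∀ v → Adj v v ≡ false
open SimpleGraph public

count : {A : Set} → (A → Bool) → List A → ℕ
count p [] = 0
count p (x ∷ xs) with p x
... | true  = suc (count p xs)
... | false = count p xs

allPairs : (n : ℕ) → List (Fin n × Fin n)
allPairs n = concatMap (λ i → map (λ j → (i , j)) (allFin n)) (allFin n)

numEdges : {n : ℕ} → SimpleGraph n → ℕ
numEdges {n} G = count (λ { (i , j) → (toℕ i <ᵇ toℕ j) ∧ Adj G i j }) (allPairs n)

data Walk {n : ℕ} (G : SimpleGraph n) : Fin n → Fin n → Set where
  here : ∀ {v} → Walk G v v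
  step : ∀ {u v w} → Adj G u v ≡ true → Walk G v w → Walk G u w

Connected : {n : ℕ} → SimpleGraph n → Set
Connected {n} G = ∀ (u w : Fin n) → Walk G u w

iter : {A : Set} → (A → A) → ℕ → A → A
iter f zero x = x
iter f (suc k) x = f (iter f k x)

-- A rotation system: for every vertex v, ρ v restricted to the neighbourhood
-- N(v) is a cyclic permutation of N(v) (maps N(v) into itself and is
-- transitive on N(v); on a finite set this means a single cycle).
IsRotationSystem : {n : ℕ} → SimpleGraph n → (Fin n → Fin n → Fin n) → Set
IsRotationSystem {n} G ρ =
  (∀ (v u : Fin n) → Adj G v u ≡ true → Adj G v (ρ v u) ≡ true) ×
  (∀ (v u w : Fin n) → Adj G v u ≡ true → Adj G v w ≡ true →
     ∃ λ k → iter (ρ v) k u ≡ w)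

faceStep : {n : ℕ} → (Fin n → Fin n → Fin n) → Fin n × Fin n → Fin n × Fin n
faceStep ρ (u , v) = (v , ρ v u)

-- Quadrangular: every face (orbit of faceStep on darts) is a closed walk
-- u₀ u₁ u₂ u₃ u₀ with u₀,…,u₃ pairwise distinct, i.e. bounded by a 4-cycle.
Quadrangular : {n : ℕ} → SimpleGraph n → (Fin n → Fin n → Fin n) → Set
Quadrangular {n} G ρ =
  ∀ (u₀ u₁ : Fin n) → Adj G u₀ u₁ ≡ true →
  Σ (Fin n) λ u₂ → Σ (Fin n) λ u₃ →
    faceStep ρ (u₀ , u₁) ≡ (u₁ , u₂) ×
    faceStep ρ (u₁ , u₂) ≡ (u₂ , u₃) ×
    faceStep ρ (u₂ , u₃) ≡ (u₃ , u₀) ×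
    faceStep ρ (u₃ , u₀) ≡ (u₀ , u₁) ×
    u₀ ≢ u₁ × u₀ ≢ u₂ × u₀ ≢ u₃ × u₁ ≢ u₂ × u₁ ≢ u₃ × u₂ ≢ u₃

-- An orientable cellular quadrangular embedding of G (Heffter–Edmonds:
-- orientable cellular embeddings of a connected graph ↔ rotation systems,
-- faces ↔ orbits of the face-tracing map).
OrientableQuadEmbedding : {n : ℕ} → SimpleGraph n → Set
OrientableQuadEmbedding {n} G =
  Connected G × Σ (Fin n → Fin n → Fin n) λ ρ → IsRotationSystem G ρ × Quadrangular G ρ

-- Split the n = 2m vertices into m pairs {L i, R i}. The graphs below carry a quadrangular rotation
-- system together with, at every vertex v, a marked face in which v is opposite its partner. Two such
-- embeddings with disjoint edge sets amalgamate: at each common vertex the successors of the two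
-- marked corners are exchanged, which joins the two rotations into one and replaces the two marked
-- faces by two new quadrilaterals, again with marked faces. The 4-cycle C4 = K(2,2) on two pairs and
-- K8 on four pairs carry such embeddings. The union of the C4's on all pairs of pairs is K_2m minus
-- the perfect matching, with C(n,2) - m edges; replacing the six C4's inside a block of four pairs by
-- a K8 adds the four matching edges of the block, and leaving out a C4 removes four edges. With g
-- blocks and s omitted C4's this gives C(n,2) - t edges for t = m - 4g + 4s, which reaches every
-- admissible t, and the graph is connected since pair 0 is joined to every other pair.

module Submission where

open import Defs
open import Data.Nat using (ℕ; zero; suc; _+_; _∸_; _<_; _≤_; s≤s; z≤n; s≤s⁻¹; _<ᵇ_; _*_; _%_; _/_; _≤?_)
open import Data.Nat.Properties using (≤-refl; m∸n+n≡m; ∸-monoʳ-<; m≤n⇒m≤1+n; m≤n⇒m<n∨m≡n; +-suc; <ᵇ⇒<; <⇒<ᵇ; <-cmp; <-asym; <-irrefl; <-≤-trans; m≤m+n; +-monoʳ-<; +-cancelˡ-<; <-trans; m+[n∸m]≡n; m+n∸m≡n; ∸-monoˡ-<; +-comm; ≤-trans; <⇒≤; n≤1+n; ≤-reflexive; ≤-antisym; m∸n≤m; m<n⇒0<n∸m; +-identityʳ; +-assoc; *-suc; *-distribˡ-+; *-monoʳ-≤; *-monoʳ-<; +-cancelˡ-≤; *-comm; m≤n⇒∃[o]m+o≡n; ≰⇒>; +-monoˡ-≤) renaming (_≟_ to _≟ℕ_)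
open import Data.Fin as Fin using (Fin; _↑ˡ_; _↑ʳ_; splitAt; toℕ; #_; fromℕ<; zero; suc)
open import Data.Bool using (Bool; true; false; _∨_; not; _∧_; if_then_else_)
open import Data.Product using (Σ; _×_; _,_; ∃; proj₂; proj₁)
open import Data.Sum using (_⊎_; inj₁; inj₂; [_,_]′)
open import Data.Empty using (⊥; ⊥-elim)
open import Relation.Nullary using (¬_; yes; no; Dec; does; ¬?)
open import Relation.Binary.Definitions using (DecidableEquality; tri<; tri≈; tri>)
import Relation.Binary.PropositionalEquality as ≡
open ≡ using (_≡_; _≢_; refl; trans; cong; subst; ≢-sym; cong₂; subst₂)
open import Data.Fin.Properties using (splitAt-↑ˡ; splitAt-↑ʳ; splitAt⁻¹-↑ˡ; splitAt⁻¹-↑ʳ; toℕ-injective; all?; any?; toℕ-fromℕ<; toℕ-↑ˡ; toℕ-↑ʳ; toℕ<n)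
open import Data.Bool.Properties using (not-¬; ¬-not; ∨-comm; ∨-conicalˡ; ∨-conicalʳ; ∧-zeroʳ; ∧-distribˡ-∨; ⇔→≡; T-≡) renaming (_≟_ to _≟ᵇ_)
import Data.Product as Product
import Data.Sum as Sum
open import Function using (_∘_; Equivalence; mk⇔)
open import Relation.Nullary.Decidable using (_×-dec_; True; toWitness; _→-dec_; dec-false)
open import Data.List using (List; []; _∷_; map; length; _++_; concatMap; filterᵇ)
open import Data.Bool.ListAction using (any)
open import Data.List.Base using (allFin)
open import Data.List.Properties using (map-tabulate; length-map)
open import Data.Product.Properties using (≡-dec)
open import Data.Maybe using (Maybe; just; nothing)
open import Data.Vec using (Vec; []; _∷_; lookup)
open import Data.Unit using (tt)
import Data.Maybe as Maybe
open import Data.Nat.Tactic.RingSolver using (solve-∀)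
open import Data.Nat.Combinatorics using (_C_; nCk+nC[k+1]≡[n+1]C[k+1]; nC1≡n)
open import Data.Nat.DivMod using (m≡m%n+[m/n]*n; [m+kn]%n≡m%n; m%n<n)
open import Data.Nat.Divisibility using (_∣_; divides)

iter-+ : {A : Set} (f : A → A) (k l : ℕ) (x : A) → iter f (k + l) x ≡ iter f k (iter f l x)
iter-+ f zero    l x = refl
iter-+ f (suc k) l x = cong f (iter-+ f k l x)

Reachable : {A : Set} → (A → A) → A → A → Set
Reachable f x y = ∃ λ k → iter f k x ≡ y

reachable-step : {A : Set} {f : A → A} {x y : A} → f x ≡ y → Reachable f x y
reachable-step e = 1 , e

reachable-trans : {A : Set} {f : A → A} {x y z : A} →
  Reachable f x y → Reachable f y z → Reachable f x z
reachable-trans {f = f} {x} (k , x↝y) (l , y↝z) =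
  l + k , trans (iter-+ f l k x) (trans (cong (iter f l) x↝y) y↝z)

module ShortestPath {A : Set} (_≟_ : DecidableEquality A) (f : A → A) where

  IsShortest : A → A → ℕ → Set
  IsShortest x y k = iter f k x ≡ y × (∀ j → j < k → iter f j x ≢ y)

  private
    search : ∀ x y k → ∃ (IsShortest x y) ⊎ (∀ j → j ≤ k → iter f j x ≢ y)
    search x y zero with x ≟ y
    ... | yes x≡y = inj₁ (0 , x≡y , λ _ ())
    ... | no  x≢y = inj₂ λ { zero _ → x≢y }
    search x y (suc k) with search x y k
    ... | inj₁ found = inj₁ found
    ... | inj₂ missed with iter f (suc k) x ≟ y
    ...   | yes hit = inj₁ (suc k , hit , λ j j<1+k → missed j (s≤s⁻¹ j<1+k))
    ...   | no miss = inj₂ λ j → missed-up-to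
      where
      missed-up-to : ∀ {j} → j ≤ suc k → iter f j x ≢ y
      missed-up-to j≤1+k with m≤n⇒m<n∨m≡n j≤1+k
      ... | inj₁ (s≤s j≤k) = missed _ j≤k
      ... | inj₂ refl      = miss

  shortest : ∀ {x y} → Reachable f x y → ∃ (IsShortest x y)
  shortest {x} {y} (k , hit) with search x y k
  ... | inj₁ found  = found
  ... | inj₂ missed = ⊥-elim (missed k ≤-refl hit)

  -- A visit to q would bring the walk back to f q, so a shorter walk would exist.
  shortest-from-successor-avoids : ∀ {q w k} → IsShortest (f q) w k →
    ∀ j → j < k → iter f j (f q) ≢ q
  shortest-from-successor-avoids {q} {w} {k} (hit , minimal) j j<k visit =
    minimal (k ∸ suc j) (∸-monoʳ-< (s≤s z≤n) j<k) shortcut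
    where
    open ≡.≡-Reasoning
    shortcut : iter f (k ∸ suc j) (f q) ≡ w
    shortcut = begin
      iter f (k ∸ suc j) (f q)                   ≡⟨ cong (iter f (k ∸ suc j)) (cong f visit) ⟨
      iter f (k ∸ suc j) (iter f (suc j) (f q))  ≡⟨ iter-+ f (k ∸ suc j) (suc j) (f q) ⟨
      iter f (k ∸ suc j + suc j) (f q)           ≡⟨ cong (λ l → iter f l (f q)) (m∸n+n≡m j<k) ⟩
      iter f k (f q)                             ≡⟨ hit ⟩
      w                                          ∎

module Agreement {A : Set} (f g : A → A) (N : A → Set) (g-closed : ∀ x → N x → N (g x)) where

  iter-closed : ∀ k x → N x → N (iter g k x)
  iter-closed zero    x Nx = Nx
  iter-closed (suc k) x Nx = g-closed _ (iter-closed k x Nx)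

  iter-agree : (Bad : A → Set) → (∀ x → N x → ¬ Bad x → f x ≡ g x) →
    ∀ k x → N x → (∀ j → j < k → ¬ Bad (iter g j x)) → iter f k x ≡ iter g k x
  iter-agree Bad agree zero    x Nx good = refl
  iter-agree Bad agree (suc k) x Nx good =
    trans (cong f (iter-agree Bad agree k x Nx λ j j<k → good j (m≤n⇒m≤1+n j<k)))
          (agree _ (iter-closed k x Nx) (good k ≤-refl))

  reachable-agree : (∀ x → N x → f x ≡ g x) → ∀ {x y} → N x → Reachable g x y → Reachable f x y
  reachable-agree agree {x} Nx (k , hit) =
    k , trans (iter-agree (λ _ → ⊥) (λ x Nx _ → agree x Nx) k x Nx (λ _ _ ())) hit

  module _ (_≟_ : DecidableEquality A) {q : A} (agree : ∀ x → N x → x ≢ q → f x ≡ g x) where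
    open ShortestPath _≟_ g

    reachable-agree-until : ∀ {x} → N x → Reachable g x q → Reachable f x q
    reachable-agree-until {x} Nx x↝q with shortest x↝q
    ... | k , hit , minimal = k , trans (iter-agree (_≡ q) agree k x Nx minimal) hit

    reachable-agree-after : ∀ {w} → N (g q) → Reachable g (g q) w → Reachable f (g q) w
    reachable-agree-after Ngq gq↝w with shortest gq↝w
    ... | k , hit , minimal =
      k , trans (iter-agree (_≡ q) agree k _ Ngq (shortest-from-successor-avoids (hit , minimal))) hit

walk-++ : {n : ℕ} {G : SimpleGraph n} {u v w : Fin n} → Walk G u v → Walk G v w → Walk G u w
walk-++ here       q = q
walk-++ (step e p) q = step e (walk-++ p q)

walk-reverse : {n : ℕ} {G : SimpleGraph n} {u v : Fin n} → Walk G u v → Walk G v u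
walk-reverse here = here
walk-reverse {G = G} (step {u} {v} e p) = walk-++ (walk-reverse p) (step (trans (sym G v u) e) here)

Distinct4 : {A : Set} → A → A → A → A → Set
Distinct4 a b c d = a ≢ b × a ≢ c × a ≢ d × b ≢ c × b ≢ d × c ≢ d

distinct4-rotate : {A : Set} {a b c d : A} → Distinct4 a b c d → Distinct4 b c d a
distinct4-rotate (ab , ac , ad , bc , bd , cd) = bc , bd , ≢-sym ab , cd , ≢-sym ac , ≢-sym ad

distinct4-exchange : {A : Set} {a b c d a' c' : A} → Distinct4 a b c d → Distinct4 a' b c' d → a ≢ c' →
  Distinct4 a b c' d
distinct4-exchange (ab , _ , ad , _ , bd , _) (_ , _ , _ , bc' , _ , c'd) ac' = ab , ac' , ad , bc' , bd , c'd

QuadFace : {n : ℕ} → (Fin n → Fin n → Fin n) → Fin n → Fin n → Set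
QuadFace {n} ρ u₀ u₁ = Σ (Fin n) λ u₂ → Σ (Fin n) λ u₃ →
  faceStep ρ (u₀ , u₁) ≡ (u₁ , u₂) ×
  faceStep ρ (u₁ , u₂) ≡ (u₂ , u₃) ×
  faceStep ρ (u₂ , u₃) ≡ (u₃ , u₀) ×
  faceStep ρ (u₃ , u₀) ≡ (u₀ , u₁) ×
  Distinct4 u₀ u₁ u₂ u₃

record Square {n : ℕ} (ρ : Fin n → Fin n → Fin n) (a b c d : Fin n) : Set where
  field
    b-turn : ρ b a ≡ c
    c-turn : ρ c b ≡ d
    d-turn : ρ d c ≡ a
    a-turn : ρ a d ≡ b
    distinct : Distinct4 a b c d

module _ {n : ℕ} {ρ : Fin n → Fin n → Fin n} where

  square-face-ab : ∀ {a b c d} → Square ρ a b c d → QuadFace ρ a b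
  square-face-ab {a} {b} {c} {d} s =
    c , d , cong (b ,_) b-turn , cong (c ,_) c-turn , cong (d ,_) d-turn , cong (a ,_) a-turn , distinct
    where open Square s

  square-rotate : ∀ {a b c d} → Square ρ a b c d → Square ρ b c d a
  square-rotate s = record
    { b-turn = c-turn ; c-turn = d-turn ; d-turn = a-turn ; a-turn = b-turn
    ; distinct = distinct4-rotate distinct }
    where open Square s

  square-face-bc : ∀ {a b c d} → Square ρ a b c d → QuadFace ρ b c
  square-face-bc s = square-face-ab (square-rotate s)

  square-face-cd : ∀ {a b c d} → Square ρ a b c d → QuadFace ρ c d
  square-face-cd s = square-face-bc (square-rotate s)

  square-face-da : ∀ {a b c d} → Square ρ a b c d → QuadFace ρ d a
  square-face-da s = square-face-cd (square-rotate s)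

  face-square : ∀ {a b} → QuadFace ρ a b → Square ρ a b (ρ b a) (ρ (ρ b a) b)
  face-square (_ , _ , refl , refl , d-step , a-step , distinct) = record
    { b-turn = refl ; c-turn = refl ; d-turn = cong proj₂ d-step
    ; a-turn = cong proj₂ a-step ; distinct = distinct }

distinct4-map : {A B : Set} (ι : A → B) → (∀ {x y} → ι x ≡ ι y → x ≡ y) →
  ∀ {a b c d} → Distinct4 a b c d → Distinct4 (ι a) (ι b) (ι c) (ι d)
distinct4-map ι ι-inj (ab , ac , ad , bc , bd , cd) = ι≢ ab , ι≢ ac , ι≢ ad , ι≢ bc , ι≢ bd , ι≢ cd
  where
  ι≢ : ∀ {x y} → x ≢ y → ι x ≢ ι y
  ι≢ x≢y eq = x≢y (ι-inj eq)

square-map : {n n' : ℕ} {ρ : Fin n → Fin n → Fin n} {ρ' : Fin n' → Fin n' → Fin n'}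
  (ι : Fin n → Fin n') → (∀ {x y} → ι x ≡ ι y → x ≡ y) → (∀ x y → ρ' (ι x) (ι y) ≡ ι (ρ x y)) →
  ∀ {a b c d} → Square ρ a b c d → Square ρ' (ι a) (ι b) (ι c) (ι d)
square-map ι ι-inj ι-ρ {a} {b} {c} {d} s = record
  { b-turn = trans (ι-ρ b a) (cong ι b-turn)
  ; c-turn = trans (ι-ρ c b) (cong ι c-turn)
  ; d-turn = trans (ι-ρ d c) (cong ι d-turn)
  ; a-turn = trans (ι-ρ a d) (cong ι a-turn)
  ; distinct = distinct4-map ι ι-inj distinct }
  where open Square s

-- Marked quadrangular embeddings

-- At an active vertex v the face (corner v, v, ρ v (corner v), pt v) is marked: v is opposite its
-- partner there, and by corner-partner it is also the marked face of pt v. corner-far ensures that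
-- splicing at the fourth vertex ρ v (corner v) leaves this face alone.
record MarkedQuad {n : ℕ} (pt : Fin n → Fin n) (G : SimpleGraph n) : Set where
  field
    ρ : Fin n → Fin n → Fin n
    active : Fin n → Bool
    inactive-isolated : ∀ v w → active v ≡ false → Adj G v w ≡ false
    active-partner : ∀ v → active (pt v) ≡ active v
    ρ-closed : ∀ v u → Adj G v u ≡ true → Adj G v (ρ v u) ≡ true
    ρ-transitive : ∀ v u w → Adj G v u ≡ true → Adj G v w ≡ true → Reachable (ρ v) u w
    quadrangular : Quadrangular G ρ
    corner : Fin n → Fin n
    corner-adjacent : ∀ v → active v ≡ true → Adj G v (corner v) ≡ true
    corner-face : ∀ v → active v ≡ true → ρ (ρ v (corner v)) v ≡ pt v
    corner-partner : ∀ v → active v ≡ true → corner (pt v) ≡ ρ v (corner v)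
    corner-far : ∀ v → active v ≡ true → corner (ρ v (corner v)) ≢ v

  adjacent-active : ∀ v w → Adj G v w ≡ true → active v ≡ true
  adjacent-active v w e with active v in act
  ... | true  = refl
  ... | false = ⊥-elim (not-¬ e (inactive-isolated v w act))

  partner-active : ∀ v → active v ≡ true → active (pt v) ≡ true
  partner-active v a = trans (active-partner v) a

  adjacent-sym : ∀ v w → Adj G v w ≡ true → Adj G w v ≡ true
  adjacent-sym v w e = trans (sym G w v) e

  turn-adjacent : ∀ {v u w} → ρ v u ≡ w → Adj G v u ≡ true → Adj G w v ≡ true
  turn-adjacent refl e = adjacent-sym _ _ (ρ-closed _ _ e)

  edge-square : ∀ u₀ u₁ → Adj G u₀ u₁ ≡ true → Square ρ u₀ u₁ (ρ u₁ u₀) (ρ (ρ u₁ u₀) u₁)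
  edge-square u₀ u₁ e = face-square (quadrangular u₀ u₁ e)

  marked-square : ∀ v → active v ≡ true → Square ρ (corner v) v (ρ v (corner v)) (pt v)
  marked-square v a = subst (Square ρ (corner v) v (ρ v (corner v))) (corner-face v a)
    (edge-square (corner v) v (adjacent-sym v (corner v) (corner-adjacent v a)))

module Halves where

  data View (d : ℕ) : Fin (d + d) → Set where
    left  : (i : Fin d) → View d (i ↑ˡ d)
    right : (i : Fin d) → View d (d ↑ʳ i)

  view : ∀ {d} (x : Fin (d + d)) → View d x
  view {d} x with splitAt d x in eq
  ... | inj₁ i = subst (View d) (splitAt⁻¹-↑ˡ eq) (left i)
  ... | inj₂ i = subst (View d) (splitAt⁻¹-↑ʳ eq) (right i)

module Pairing (m : ℕ) where
  open Halves public

  L R : Fin m → Fin (m + m)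
  L i = i ↑ˡ m
  R i = m ↑ʳ i

  partner : Fin (m + m) → Fin (m + m)
  partner v = [ R , L ]′ (splitAt m v)

  isLeft : Fin (m + m) → Bool
  isLeft v = [ (λ _ → true) , (λ _ → false) ]′ (splitAt m v)

  index : Fin (m + m) → Fin m
  index v = [ (λ i → i) , (λ i → i) ]′ (splitAt m v)

  partner-L : ∀ i → partner (L i) ≡ R i
  partner-L i rewrite splitAt-↑ˡ m i m = refl
  partner-R : ∀ i → partner (R i) ≡ L i
  partner-R i rewrite splitAt-↑ʳ m m i = refl
  isLeft-L : ∀ i → isLeft (L i) ≡ true
  isLeft-L i rewrite splitAt-↑ˡ m i m = refl
  isLeft-R : ∀ i → isLeft (R i) ≡ false
  isLeft-R i rewrite splitAt-↑ʳ m m i = refl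
  index-L : ∀ i → index (L i) ≡ i
  index-L i rewrite splitAt-↑ˡ m i m = refl
  index-R : ∀ i → index (R i) ≡ i
  index-R i rewrite splitAt-↑ʳ m m i = refl

  partner-involutive : ∀ v → partner (partner v) ≡ v
  partner-involutive v with view {m} v
  ... | left i  rewrite partner-L i = partner-R i
  ... | right i rewrite partner-R i = partner-L i

  isLeft-partner : ∀ v → isLeft (partner v) ≡ not (isLeft v)
  isLeft-partner v with view {m} v
  ... | left i  rewrite partner-L i | isLeft-L i | isLeft-R i = refl
  ... | right i rewrite partner-R i | isLeft-L i | isLeft-R i = refl

-- Amalgamation

∨-introˡ : ∀ {a b} → a ≡ true → a ∨ b ≡ true
∨-introˡ refl = refl

∨-introʳ : ∀ {a b} → b ≡ true → a ∨ b ≡ true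
∨-introʳ {true}  refl = refl
∨-introʳ {false} refl = refl

∨-elim : ∀ a {b} → a ∨ b ≡ true → a ≡ true ⊎ b ≡ true
∨-elim true  _ = inj₁ refl
∨-elim false e = inj₂ e

_∪ᴳ_ : {n : ℕ} → SimpleGraph n → SimpleGraph n → SimpleGraph n
G₁ ∪ᴳ G₂ = record
  { Adj    = λ u v → Adj G₁ u v ∨ Adj G₂ u v
  ; sym    = λ u v → cong₂ _∨_ (sym G₁ u v) (sym G₂ u v)
  ; irrefl = λ v → cong₂ _∨_ (irrefl G₁ v) (irrefl G₂ v) }

record EdgeDisjoint {n : ℕ} (G₁ G₂ : SimpleGraph n) : Set where
  constructor edge-disjoint
  field apart : ∀ u v → Adj G₁ u v ≡ true → Adj G₂ u v ≡ false

module _ {n : ℕ} {G₁ G₂ : SimpleGraph n} (disjoint : EdgeDisjoint G₁ G₂) where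

  open EdgeDisjoint disjoint

  edge-disjoint-sym : EdgeDisjoint G₂ G₁
  edge-disjoint-sym = edge-disjoint λ u v e₂ → ¬-not λ e₁ → not-¬ e₂ (apart u v e₁)

  neighbours-distinct : ∀ {v x y} → Adj G₁ v x ≡ true → Adj G₂ v y ≡ true → x ≢ y
  neighbours-distinct {v} {x} e₁ e₂ refl = not-¬ e₂ (apart v x e₁)

module _ {n : ℕ} {pt : Fin n → Fin n} {G₁ G₂ : SimpleGraph n}
         (Q₁ : MarkedQuad pt G₁) (Q₂ : MarkedQuad pt G₂) where
  private
    module Q₁ = MarkedQuad Q₁
    module Q₂ = MarkedQuad Q₂

  Shared : Fin n → Set
  Shared v = Q₁.active v ≡ true × Q₂.active v ≡ true

  shared? : ∀ v → Dec (Shared v)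
  shared? v = (Q₁.active v ≟ᵇ true) ×-dec (Q₂.active v ≟ᵇ true)

  -- ρ joins the rotations of Q₁ and Q₂ at every shared vertex v: the successors of the two
  -- marked corners of v are exchanged.
  record Splice (ρ : Fin n → Fin n → Fin n) : Set where
    field
      keep₁  : ∀ v w → Adj G₁ v w ≡ true → ¬ (Shared v × w ≡ Q₁.corner v) → ρ v w ≡ Q₁.ρ v w
      keep₂  : ∀ v w → Adj G₂ v w ≡ true → ¬ (Shared v × w ≡ Q₂.corner v) → ρ v w ≡ Q₂.ρ v w
      cross₁ : ∀ v → Shared v → ρ v (Q₁.corner v) ≡ Q₂.ρ v (Q₂.corner v)
      cross₂ : ∀ v → Shared v → ρ v (Q₂.corner v) ≡ Q₁.ρ v (Q₁.corner v)

splice-swap : {n : ℕ} {pt : Fin n → Fin n} {G₁ G₂ : SimpleGraph n}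
  {Q₁ : MarkedQuad pt G₁} {Q₂ : MarkedQuad pt G₂} {ρ : Fin n → Fin n → Fin n} →
  Splice Q₁ Q₂ ρ → Splice Q₂ Q₁ ρ
splice-swap S = record
  { keep₁  = λ v w e ¬sp → keep₂ v w e λ (sh , eq) → ¬sp (Product.swap sh , eq)
  ; keep₂  = λ v w e ¬sp → keep₁ v w e λ (sh , eq) → ¬sp (Product.swap sh , eq)
  ; cross₁ = λ v sh → cross₂ v (Product.swap sh)
  ; cross₂ = λ v sh → cross₁ v (Product.swap sh) }
  where open Splice S

module SplicedSquare {n : ℕ} {pt : Fin n → Fin n} {G₁ G₂ : SimpleGraph n}
  {Q₁ : MarkedQuad pt G₁} {Q₂ : MarkedQuad pt G₂} (disjoint : EdgeDisjoint G₁ G₂)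
  {ρ : Fin n → Fin n → Fin n} (S : Splice Q₁ Q₂ ρ) where
  private
    module Q₁ = MarkedQuad Q₁
    module Q₂ = MarkedQuad Q₂
  open Splice S

  spliced? : ∀ v w → Dec (Shared Q₁ Q₂ v × w ≡ Q₁.corner v)
  spliced? v w = shared? Q₁ Q₂ v ×-dec (w Fin.≟ Q₁.corner v)

  -- The marked faces (c₁, v, a₁, pt v) and (c₂, v, a₂, pt v) are replaced by (c₁, v, a₂, pt v)
  -- and (c₂, v, a₁, pt v).
  shared-square : ∀ v → Shared Q₁ Q₂ v →
    Square ρ (Q₁.corner v) v (Q₂.ρ v (Q₂.corner v)) (pt v)
  shared-square v sh@(act₁ , act₂) = record
    { b-turn = cross₁ v sh
    ; c-turn = trans (keep₂ a₂ v (Q₂.adjacent-sym v a₂ v~a₂) λ (_ , eq) → Q₂.corner-far v act₂ (≡.sym eq))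
                     (Q₂.corner-face v act₂)
    ; d-turn = begin
        ρ u a₂                     ≡⟨ cong (ρ u) (Q₂.corner-partner v act₂) ⟨
        ρ u (Q₂.corner u)          ≡⟨ cross₂ u (Q₁.partner-active v act₁ , Q₂.partner-active v act₂) ⟩
        Q₁.ρ u (Q₁.corner u)       ≡⟨ u-turn₁ ⟩
        c₁                         ∎
    ; a-turn = trans (keep₁ c₁ u (Q₁.turn-adjacent u-turn₁ (Q₁.corner-adjacent u (Q₁.partner-active v act₁)))
                       λ (_ , eq) → Q₁.corner-far u (Q₁.partner-active v act₁) (trans (cong Q₁.corner u-turn₁) (≡.sym eq)))
                     (Square.a-turn K₁)
    ; distinct = distinct4-exchange (Square.distinct K₁) (Square.distinct K₂)
                   (neighbours-distinct disjoint (Q₁.corner-adjacent v act₁) v~a₂) }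
    where
    open ≡.≡-Reasoning
    c₁ = Q₁.corner v
    a₂ = Q₂.ρ v (Q₂.corner v)
    u  = pt v
    K₁ : Square Q₁.ρ c₁ v (Q₁.ρ v c₁) u
    K₁ = Q₁.marked-square v act₁
    K₂ : Square Q₂.ρ (Q₂.corner v) v a₂ u
    K₂ = Q₂.marked-square v act₂
    v~a₂ : Adj G₂ v a₂ ≡ true
    v~a₂ = Q₂.ρ-closed v (Q₂.corner v) (Q₂.corner-adjacent v act₂)
    u-turn₁ : Q₁.ρ u (Q₁.corner u) ≡ c₁
    u-turn₁ = trans (cong (Q₁.ρ u) (Q₁.corner-partner v act₁)) (Square.d-turn K₁)

  closed₁ : ∀ v u → Adj G₁ v u ≡ true → Adj G₁ v (ρ v u) ≡ true ⊎ Adj G₂ v (ρ v u) ≡ true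
  closed₁ v u e with spliced? v u
  ... | yes (sh@(_ , act₂) , refl) =
    inj₂ (subst (λ w → Adj G₂ v w ≡ true) (≡.sym (cross₁ v sh)) (Q₂.ρ-closed v _ (Q₂.corner-adjacent v act₂)))
  ... | no ¬sp = inj₁ (subst (λ w → Adj G₁ v w ≡ true) (≡.sym (keep₁ v u e ¬sp)) (Q₁.ρ-closed v u e))

  module _ {v : Fin n} (act₁ : Q₁.active v ≡ true) where
    private
      module A = Agreement (ρ v) (Q₁.ρ v) (λ x → Adj G₁ v x ≡ true) (Q₁.ρ-closed v)
      agree : ∀ x → Adj G₁ v x ≡ true → x ≢ Q₁.corner v → ρ v x ≡ Q₁.ρ v x
      agree x e x≢c = keep₁ v x e λ (_ , eq) → x≢c eq

    reaches-corner₁ : ∀ {x} → Adj G₁ v x ≡ true → Reachable (ρ v) x (Q₁.corner v)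
    reaches-corner₁ {x} e =
      A.reachable-agree-until Fin._≟_ agree e (Q₁.ρ-transitive v x _ e (Q₁.corner-adjacent v act₁))

    reaches-from-successor₁ : ∀ {w} → Adj G₁ v w ≡ true →
      Reachable (ρ v) (Q₁.ρ v (Q₁.corner v)) w
    reaches-from-successor₁ {w} e =
      A.reachable-agree-after Fin._≟_ agree successor~ (Q₁.ρ-transitive v _ w successor~ e)
      where successor~ = Q₁.ρ-closed v _ (Q₁.corner-adjacent v act₁)

    unshared-transitive : ¬ Shared Q₁ Q₂ v → ∀ {u w} → Adj G₁ v u ≡ true → Adj G₁ v w ≡ true →
      Reachable (ρ v) u w
    unshared-transitive ¬sh {u} {w} e e' =
      A.reachable-agree (λ x e → keep₁ v x e λ (sh , _) → ¬sh sh) e (Q₁.ρ-transitive v u w e e')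

module Spliced {n : ℕ} {pt : Fin n → Fin n} {G₁ G₂ : SimpleGraph n}
  {Q₁ : MarkedQuad pt G₁} {Q₂ : MarkedQuad pt G₂} (disjoint : EdgeDisjoint G₁ G₂)
  {ρ : Fin n → Fin n → Fin n} (S : Splice Q₁ Q₂ ρ) where
  private
    module Q₁ = MarkedQuad Q₁
    module Q₂ = MarkedQuad Q₂
    module S₁ = SplicedSquare disjoint S
    module S₂ = SplicedSquare (edge-disjoint-sym disjoint) (splice-swap S)
  open Splice S
  open S₁ public using (closed₁)

  -- A face of Q₁ survives unless one of its turns is spliced; it is then one of the new faces.
  faces₁ : ∀ {a b} → Adj G₁ a b ≡ true → QuadFace ρ a b
  faces₁ {a} {b} ab = from-square (Q₁.edge-square a b ab) ab
    where
    from-square : ∀ {a b c d} → Square Q₁.ρ a b c d → Adj G₁ a b ≡ true → QuadFace ρ a b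
    from-square {a} {b} {c} {d} K ab with S₁.spliced? b a
    ... | yes (sh , refl) = square-face-ab (S₁.shared-square b sh)
    ... | no ¬b with S₁.spliced? c b
    ...   | yes (sh@(act₁ , _) , refl) =
      subst (λ x → QuadFace ρ x b) pt-c≡a (square-face-da (S₁.shared-square c sh))
      where
      open Square K
      pt-c≡a : pt c ≡ a
      pt-c≡a = trans (≡.sym (Q₁.corner-face c act₁)) (trans (cong (λ t → Q₁.ρ t c) c-turn) d-turn)
    ...   | no ¬c with S₁.spliced? d c
    ...     | yes (sh@(act₁ , _) , refl) =
      subst₂ (QuadFace ρ) d-turn pt-d≡b (square-face-cd (S₂.shared-square d (Product.swap sh)))
      where
      open Square K
      pt-d≡b : pt d ≡ b
      pt-d≡b = trans (≡.sym (Q₁.corner-face d act₁)) (trans (cong (λ t → Q₁.ρ t d) d-turn) a-turn)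
    ...     | no ¬d with S₁.spliced? a d
    ...       | yes (sh , refl) =
      subst (QuadFace ρ a) (Square.a-turn K) (square-face-bc (S₂.shared-square a (Product.swap sh)))
    ...       | no ¬a = square-face-ab (record
      { b-turn = trans (keep₁ b a ba ¬b) b-turn
      ; c-turn = trans (keep₁ c b cb ¬c) c-turn
      ; d-turn = trans (keep₁ d c dc ¬d) d-turn
      ; a-turn = trans (keep₁ a d ad ¬a) a-turn
      ; distinct = distinct })
      where
      open Square K
      ba = Q₁.adjacent-sym a b ab
      cb = Q₁.turn-adjacent b-turn ba
      dc = Q₁.turn-adjacent c-turn cb
      ad = Q₁.turn-adjacent d-turn dc

  -- At a shared vertex the two rotation cycles are cut after c₁ and c₂ and rejoined into the single
  -- cycle c₁ → a₂ → ⋯ → c₂ → a₁ → ⋯ → c₁.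
  transitive : ∀ v u w → Adj (G₁ ∪ᴳ G₂) v u ≡ true → Adj (G₁ ∪ᴳ G₂) v w ≡ true →
    Reachable (ρ v) u w
  transitive v u w vu vw with shared? Q₁ Q₂ v
  ... | yes sh@(act₁ , act₂) = reachable-trans (to-corner (∨-elim _ vu)) (from-corner (∨-elim _ vw))
    where
    a₁~ : Adj G₁ v (Q₁.ρ v (Q₁.corner v)) ≡ true
    a₁~ = Q₁.ρ-closed v _ (Q₁.corner-adjacent v act₁)
    a₂~ : Adj G₂ v (Q₂.ρ v (Q₂.corner v)) ≡ true
    a₂~ = Q₂.ρ-closed v _ (Q₂.corner-adjacent v act₂)
    to-corner : ∀ {x} → Adj G₁ v x ≡ true ⊎ Adj G₂ v x ≡ true → Reachable (ρ v) x (Q₁.corner v)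
    to-corner (inj₁ e) = S₁.reaches-corner₁ act₁ e
    to-corner (inj₂ e) = reachable-trans (S₂.reaches-corner₁ act₂ e)
      (reachable-trans (reachable-step (cross₂ v sh)) (S₁.reaches-corner₁ act₁ a₁~))
    from-corner : ∀ {x} → Adj G₁ v x ≡ true ⊎ Adj G₂ v x ≡ true → Reachable (ρ v) (Q₁.corner v) x
    from-corner (inj₂ e) = reachable-trans (reachable-step (cross₁ v sh)) (S₂.reaches-from-successor₁ act₂ e)
    from-corner (inj₁ e) = reachable-trans (reachable-step (cross₁ v sh))
      (reachable-trans (S₂.reaches-corner₁ act₂ a₂~)
      (reachable-trans (reachable-step (cross₂ v sh)) (S₁.reaches-from-successor₁ act₁ e)))
  ... | no ¬sh with ∨-elim _ vu | ∨-elim _ vw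
  ...   | inj₁ e | inj₁ e' = S₁.unshared-transitive (Q₁.adjacent-active v u e) ¬sh e e'
  ...   | inj₂ e | inj₂ e' = S₂.unshared-transitive (Q₂.adjacent-active v u e) (¬sh ∘ Product.swap) e e'
  ...   | inj₁ e | inj₂ e' = ⊥-elim (¬sh (Q₁.adjacent-active v u e , Q₂.adjacent-active v w e'))
  ...   | inj₂ e | inj₁ e' = ⊥-elim (¬sh (Q₁.adjacent-active v w e' , Q₂.adjacent-active v u e))

module SplicedMarking {n : ℕ} {pt : Fin n → Fin n} {G₁ G₂ : SimpleGraph n}
  {Q₁ : MarkedQuad pt G₁} {Q₂ : MarkedQuad pt G₂} (disjoint : EdgeDisjoint G₁ G₂)
  {ρ : Fin n → Fin n → Fin n} (S : Splice Q₁ Q₂ ρ) (corner : Fin n → Fin n)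
  (corner-choice : ∀ x → MarkedQuad.active Q₁ x ∨ MarkedQuad.active Q₂ x ≡ true →
     (MarkedQuad.active Q₁ x ≡ true × corner x ≡ MarkedQuad.corner Q₁ x) ⊎
     (MarkedQuad.active Q₂ x ≡ true × corner x ≡ MarkedQuad.corner Q₂ x)) where
  private
    module Q₁ = MarkedQuad Q₁
    module Q₂ = MarkedQuad Q₂
    module S₁ = SplicedSquare disjoint S
  open Splice S

  MarkedAt : Fin n → Set
  MarkedAt v = ρ (ρ v (corner v)) v ≡ pt v × corner (pt v) ≡ ρ v (corner v) × corner (ρ v (corner v)) ≢ v

  shared-marked : ∀ v → Shared Q₁ Q₂ v →
    corner v ≡ Q₁.corner v → corner (pt v) ≡ Q₂.corner (pt v) → MarkedAt v
  shared-marked v sh@(act₁ , act₂) c≡ pt-c≡ = face , partner , far-from ∘ trans (cong corner (≡.sym turn))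
    where
    a₂ = Q₂.ρ v (Q₂.corner v)
    turn : ρ v (corner v) ≡ a₂
    turn = trans (cong (ρ v) c≡) (cross₁ v sh)
    face : ρ (ρ v (corner v)) v ≡ pt v
    face = trans (cong (λ t → ρ t v) turn) (Square.c-turn (S₁.shared-square v sh))
    partner : corner (pt v) ≡ ρ v (corner v)
    partner = trans pt-c≡ (trans (Q₂.corner-partner v act₂) (≡.sym turn))
    a₂~v : Adj G₂ a₂ v ≡ true
    a₂~v = Q₂.turn-adjacent refl (Q₂.corner-adjacent v act₂)
    far-from : corner a₂ ≢ v
    far-from eq with corner-choice a₂ (∨-introʳ (Q₂.adjacent-active a₂ v a₂~v))
    ... | inj₁ (act₁' , c≡₁) =
      neighbours-distinct disjoint (Q₁.corner-adjacent a₂ act₁') a₂~v (trans (≡.sym c≡₁) eq)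
    ... | inj₂ (_ , c≡₂) = Q₂.corner-far v act₂ (trans (≡.sym c≡₂) eq)

  unshared-marked : ∀ v → Q₁.active v ≡ true → Q₂.active v ≡ false →
    corner v ≡ Q₁.corner v → corner (pt v) ≡ Q₁.corner (pt v) → MarkedAt v
  unshared-marked v act₁ inact₂ c≡ pt-c≡ = face , partner , far-from ∘ trans (cong corner (≡.sym turn))
    where
    a₁ = Q₁.ρ v (Q₁.corner v)
    turn : ρ v (corner v) ≡ a₁
    turn = trans (cong (ρ v) c≡)
      (keep₁ v _ (Q₁.corner-adjacent v act₁) λ ((_ , act₂) , _) → not-¬ act₂ inact₂)
    a₁~v : Adj G₁ a₁ v ≡ true
    a₁~v = Q₁.turn-adjacent refl (Q₁.corner-adjacent v act₁)
    face : ρ (ρ v (corner v)) v ≡ pt v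
    face = trans (cong (λ t → ρ t v) turn)
      (trans (keep₁ a₁ v a₁~v λ (_ , eq) → Q₁.corner-far v act₁ (≡.sym eq)) (Q₁.corner-face v act₁))
    partner : corner (pt v) ≡ ρ v (corner v)
    partner = trans pt-c≡ (trans (Q₁.corner-partner v act₁) (≡.sym turn))
    far-from : corner a₁ ≢ v
    far-from eq with corner-choice a₁ (∨-introˡ (Q₁.adjacent-active a₁ v a₁~v))
    ... | inj₁ (_ , c≡₁) = Q₁.corner-far v act₁ (trans (≡.sym c≡₁) eq)
    ... | inj₂ (act₂' , c≡₂) =
      neighbours-distinct disjoint a₁~v (Q₂.corner-adjacent a₁ act₂') (trans (≡.sym eq) c≡₂)

-- isLeft picks one vertex of each pair {v, pt v}: at a shared vertex the new marked corner is the
-- Q₁-corner on the left and the Q₂-corner on the right, so that v and pt v still mark the same face.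
module Amalgamation {n : ℕ} {pt : Fin n → Fin n} (isLeft : Fin n → Bool)
  (isLeft-partner : ∀ v → isLeft (pt v) ≡ not (isLeft v))
  {G₁ G₂ : SimpleGraph n} (Q₁ : MarkedQuad pt G₁) (Q₂ : MarkedQuad pt G₂)
  (disjoint : EdgeDisjoint G₁ G₂) where
  private
    module Q₁ = MarkedQuad Q₁
    module Q₂ = MarkedQuad Q₂

  unspliced : Fin n → Fin n → Fin n
  unspliced v w = if Adj G₁ v w then Q₁.ρ v w else Q₂.ρ v w

  spliced : Fin n → Fin n → Fin n
  spliced v w with shared? Q₁ Q₂ v
  ... | no _ = unspliced v w
  ... | yes _ with w Fin.≟ Q₁.corner v
  ...   | yes _ = Q₂.ρ v (Q₂.corner v)
  ...   | no _ with w Fin.≟ Q₂.corner v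
  ...     | yes _ = Q₁.ρ v (Q₁.corner v)
  ...     | no _ = unspliced v w

  private
    unspliced₁ : ∀ {v w} → Adj G₁ v w ≡ true → unspliced v w ≡ Q₁.ρ v w
    unspliced₁ e rewrite e = refl

    unspliced₂ : ∀ {v w} → Adj G₂ v w ≡ true → unspliced v w ≡ Q₂.ρ v w
    unspliced₂ {v} {w} e rewrite EdgeDisjoint.apart (edge-disjoint-sym disjoint) v w e = refl

  splice : Splice Q₁ Q₂ spliced
  splice = record { keep₁ = keep₁ ; keep₂ = keep₂ ; cross₁ = cross₁ ; cross₂ = cross₂ }
    where
    keep₁ : ∀ v w → Adj G₁ v w ≡ true → ¬ (Shared Q₁ Q₂ v × w ≡ Q₁.corner v) → spliced v w ≡ Q₁.ρ v w
    keep₁ v w e ¬sp with shared? Q₁ Q₂ v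
    ... | no _ = unspliced₁ e
    ... | yes sh with w Fin.≟ Q₁.corner v
    ...   | yes eq = ⊥-elim (¬sp (sh , eq))
    ...   | no _ with w Fin.≟ Q₂.corner v
    ...     | yes eq = ⊥-elim (neighbours-distinct disjoint e (Q₂.corner-adjacent v (proj₂ sh)) eq)
    ...     | no _ = unspliced₁ e
    keep₂ : ∀ v w → Adj G₂ v w ≡ true → ¬ (Shared Q₁ Q₂ v × w ≡ Q₂.corner v) → spliced v w ≡ Q₂.ρ v w
    keep₂ v w e ¬sp with shared? Q₁ Q₂ v
    ... | no _ = unspliced₂ e
    ... | yes sh with w Fin.≟ Q₁.corner v
    ...   | yes eq = ⊥-elim (neighbours-distinct disjoint (Q₁.corner-adjacent v (proj₁ sh)) e (≡.sym eq))
    ...   | no _ with w Fin.≟ Q₂.corner v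
    ...     | yes eq = ⊥-elim (¬sp (sh , eq))
    ...     | no _ = unspliced₂ e
    cross₁ : ∀ v → Shared Q₁ Q₂ v → spliced v (Q₁.corner v) ≡ Q₂.ρ v (Q₂.corner v)
    cross₁ v sh with shared? Q₁ Q₂ v
    ... | no ¬sh = ⊥-elim (¬sh sh)
    ... | yes _ with Q₁.corner v Fin.≟ Q₁.corner v
    ...   | yes _ = refl
    ...   | no ne = ⊥-elim (ne refl)
    cross₂ : ∀ v → Shared Q₁ Q₂ v → spliced v (Q₂.corner v) ≡ Q₁.ρ v (Q₁.corner v)
    cross₂ v sh@(act₁ , act₂) with shared? Q₁ Q₂ v
    ... | no ¬sh = ⊥-elim (¬sh sh)
    ... | yes _ with Q₂.corner v Fin.≟ Q₁.corner v
    ...   | yes eq = ⊥-elim (neighbours-distinct disjoint (Q₁.corner-adjacent v act₁)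
                                (Q₂.corner-adjacent v act₂) (≡.sym eq))
    ...   | no _ with Q₂.corner v Fin.≟ Q₂.corner v
    ...     | yes _ = refl
    ...     | no ne = ⊥-elim (ne refl)

  corner : Fin n → Fin n
  corner v = if Q₁.active v ∧ Q₂.active v
    then (if isLeft v then Q₁.corner v else Q₂.corner v)
    else (if Q₁.active v then Q₁.corner v else Q₂.corner v)

  corner-choice : ∀ x → Q₁.active x ∨ Q₂.active x ≡ true →
    (Q₁.active x ≡ true × corner x ≡ Q₁.corner x) ⊎ (Q₂.active x ≡ true × corner x ≡ Q₂.corner x)
  corner-choice x e with Q₁.active x | Q₂.active x | isLeft x
  ... | true  | true  | true  = inj₁ (refl , refl)
  ... | true  | true  | false = inj₂ (refl , refl)
  ... | true  | false | _     = inj₁ (refl , refl)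
  ... | false | true  | _     = inj₂ (refl , refl)

  private
    module Sp₁ = Spliced disjoint splice
    module Sp₂ = Spliced (edge-disjoint-sym disjoint) (splice-swap splice)
    module M₁ = SplicedMarking disjoint splice corner corner-choice
    module M₂ = SplicedMarking (edge-disjoint-sym disjoint) (splice-swap splice) corner
      (λ x e → Sum.swap (corner-choice x (trans (∨-comm (Q₁.active x) _) e)))

    marked : ∀ v → Q₁.active v ∨ Q₂.active v ≡ true → M₁.MarkedAt v
    marked v e = by-cases (Q₁.active v) (Q₂.active v) (isLeft v) refl refl refl e
      where
      by-cases : ∀ a₁ a₂ l → Q₁.active v ≡ a₁ → Q₂.active v ≡ a₂ → isLeft v ≡ l → a₁ ∨ a₂ ≡ true →
        M₁.MarkedAt v
      by-cases true true true act₁ act₂ left _ = M₁.shared-marked v (act₁ , act₂) c≡ pt-c≡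
        where
        c≡ : corner v ≡ Q₁.corner v
        c≡ rewrite act₁ | act₂ | left = refl
        pt-c≡ : corner (pt v) ≡ Q₂.corner (pt v)
        pt-c≡ rewrite Q₁.active-partner v | Q₂.active-partner v | act₁ | act₂ | isLeft-partner v | left = refl
      by-cases true true false act₁ act₂ left _ = M₂.shared-marked v (act₂ , act₁) c≡ pt-c≡
        where
        c≡ : corner v ≡ Q₂.corner v
        c≡ rewrite act₁ | act₂ | left = refl
        pt-c≡ : corner (pt v) ≡ Q₁.corner (pt v)
        pt-c≡ rewrite Q₁.active-partner v | Q₂.active-partner v | act₁ | act₂ | isLeft-partner v | left = refl
      by-cases true false _ act₁ inact₂ _ _ = M₁.unshared-marked v act₁ inact₂ c≡ pt-c≡
        where
        c≡ : corner v ≡ Q₁.corner v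
        c≡ rewrite act₁ | inact₂ = refl
        pt-c≡ : corner (pt v) ≡ Q₁.corner (pt v)
        pt-c≡ rewrite Q₁.active-partner v | Q₂.active-partner v | act₁ | inact₂ = refl
      by-cases false true _ inact₁ act₂ _ _ = M₂.unshared-marked v act₂ inact₁ c≡ pt-c≡
        where
        c≡ : corner v ≡ Q₂.corner v
        c≡ rewrite inact₁ | act₂ = refl
        pt-c≡ : corner (pt v) ≡ Q₂.corner (pt v)
        pt-c≡ rewrite Q₁.active-partner v | Q₂.active-partner v | inact₁ | act₂ = refl

  amalgam : MarkedQuad pt (G₁ ∪ᴳ G₂)
  amalgam = record
    { ρ = spliced
    ; active = λ v → Q₁.active v ∨ Q₂.active v
    ; inactive-isolated = λ v w e → cong₂ _∨_
        (Q₁.inactive-isolated v w (∨-conicalˡ _ _ e)) (Q₂.inactive-isolated v w (∨-conicalʳ _ _ e))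
    ; active-partner = λ v → cong₂ _∨_ (Q₁.active-partner v) (Q₂.active-partner v)
    ; ρ-closed = closed
    ; ρ-transitive = Sp₁.transitive
    ; quadrangular = faces
    ; corner = corner
    ; corner-adjacent = corner-adjacent
    ; corner-face = λ v e → proj₁ (marked v e)
    ; corner-partner = λ v e → proj₁ (proj₂ (marked v e))
    ; corner-far = λ v e → proj₂ (proj₂ (marked v e))
    }
    where
    closed : ∀ v u → Adj (G₁ ∪ᴳ G₂) v u ≡ true → Adj (G₁ ∪ᴳ G₂) v (spliced v u) ≡ true
    closed v u e with ∨-elim _ e
    ... | inj₁ e₁ = Sum.[ ∨-introˡ , ∨-introʳ ] (Sp₁.closed₁ v u e₁)
    ... | inj₂ e₂ = Sum.[ ∨-introʳ , ∨-introˡ ] (Sp₂.closed₁ v u e₂)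
    faces : Quadrangular (G₁ ∪ᴳ G₂) spliced
    faces u₀ u₁ e with ∨-elim _ e
    ... | inj₁ e₁ = Sp₁.faces₁ e₁
    ... | inj₂ e₂ = Sp₂.faces₁ e₂
    corner-adjacent : ∀ v → Q₁.active v ∨ Q₂.active v ≡ true → Adj (G₁ ∪ᴳ G₂) v (corner v) ≡ true
    corner-adjacent v e with corner-choice v e
    ... | inj₁ (act₁ , c≡) = ∨-introˡ (subst (λ c → Adj G₁ v c ≡ true) (≡.sym c≡) (Q₁.corner-adjacent v act₁))
    ... | inj₂ (act₂ , c≡) = ∨-introʳ (subst (λ c → Adj G₂ v c ≡ true) (≡.sym c≡) (Q₂.corner-adjacent v act₂))

-- Counting edges

module _ {A : Set} where

  count-ext : {p q : A → Bool} → (∀ x → p x ≡ q x) → ∀ xs → count p xs ≡ count q xs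
  count-ext             p≡q []       = refl
  count-ext {p = p} {q} p≡q (x ∷ xs) with p x | q x | p≡q x
  ... | true  | true  | refl = cong suc (count-ext p≡q xs)
  ... | false | false | refl = count-ext p≡q xs

  count-false : ∀ xs → count (λ (_ : A) → false) xs ≡ 0
  count-false []       = refl
  count-false (x ∷ xs) = count-false xs

  count-++ : (p : A → Bool) (xs ys : List A) → count p (xs ++ ys) ≡ count p xs + count p ys
  count-++ p []       ys = refl
  count-++ p (x ∷ xs) ys with p x
  ... | true  = cong suc (count-++ p xs ys)
  ... | false = count-++ p xs ys

  count-∨ : (p q : A → Bool) → (∀ x → p x ∧ q x ≡ false) → ∀ xs →
    count (λ x → p x ∨ q x) xs ≡ count p xs + count q xs
  count-∨ p q exclusive []       = refl
  count-∨ p q exclusive (x ∷ xs) with p x | q x | exclusive x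
  ... | true  | false | _ = cong suc (count-∨ p q exclusive xs)
  ... | false | true  | _ = trans (cong suc (count-∨ p q exclusive xs)) (≡.sym (+-suc _ _))
  ... | false | false | _ = count-∨ p q exclusive xs

count-map : {A B : Set} (p : B → Bool) (f : A → B) (xs : List A) →
  count p (map f xs) ≡ count (λ x → p (f x)) xs
count-map p f []       = refl
count-map p f (x ∷ xs) with p (f x)
... | true  = cong suc (count-map p f xs)
... | false = count-map p f xs

_≟²_ : {n : ℕ} → DecidableEquality (Fin n × Fin n)
_≟²_ = ≡-dec Fin._≟_ Fin._≟_

count-allFin-≟ : ∀ {n} (a : Fin n) → count (λ i → does (i Fin.≟ a)) (allFin n) ≡ 1
count-allFin-≟ {suc n} Fin.zero
  rewrite ≡.sym (map-tabulate {n = n} (λ i → i) Fin.suc)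
  = cong suc (trans (count-map _ Fin.suc (allFin n)) (count-false (allFin n)))
count-allFin-≟ {suc n} (Fin.suc a)
  rewrite ≡.sym (map-tabulate {n = n} (λ i → i) Fin.suc)
  = trans (count-map _ Fin.suc (allFin n)) (count-allFin-≟ a)

module _ {n : ℕ} where

  does-≟² : ∀ (i j a b : Fin n) → does ((i , j) ≟² (a , b)) ≡ does (i Fin.≟ a) ∧ does (j Fin.≟ b)
  does-≟² i j a b with i Fin.≟ a
  ... | no _ = refl
  ... | yes refl with j Fin.≟ b
  ...   | yes refl = refl
  ...   | no _     = refl

  count-allPairs-≟ : (e : Fin n × Fin n) → count (λ z → does (z ≟² e)) (allPairs n) ≡ 1
  count-allPairs-≟ (a , b) = trans (rows (allFin n)) (count-allFin-≟ a)
    where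
    row : ∀ i → count (λ z → does (z ≟² (a , b))) (map (i ,_) (allFin n))
              ≡ (if does (i Fin.≟ a) then 1 else 0)
    row i with trans (count-map _ (i ,_) (allFin n)) (count-ext (λ j → does-≟² i j a b) (allFin n))
    ... | split with i Fin.≟ a
    ...   | yes _ = trans split (count-allFin-≟ b)
    ...   | no _  = trans split (count-false (allFin n))
    rows : ∀ is → count (λ z → does (z ≟² (a , b))) (concatMap (λ i → map (i ,_) (allFin n)) is)
                ≡ count (λ i → does (i Fin.≟ a)) is
    rows []       = refl
    rows (i ∷ is) with count-++ (λ z → does (z ≟² (a , b))) (map (i ,_) (allFin n))
                                (concatMap (λ i → map (i ,_) (allFin n)) is)
    ... | split with i Fin.≟ a | row i
    ...   | yes _ | r = trans split (cong₂ _+_ r (rows is))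
    ...   | no _  | r = trans split (cong₂ _+_ r (rows is))

  private
    not-true : ∀ {x} → not x ≡ true → x ≡ false
    not-true {false} _ = refl

  _∈ᵇ_ : Fin n × Fin n → List (Fin n × Fin n) → Bool
  z ∈ᵇ L = any (λ e → does (z ≟² e)) L

  noDuplicates : List (Fin n × Fin n) → Bool
  noDuplicates []      = true
  noDuplicates (e ∷ L) = not (e ∈ᵇ L) ∧ noDuplicates L

  count-∈ᵇ : ∀ L → noDuplicates L ≡ true → count (_∈ᵇ L) (allPairs n) ≡ length L
  count-∈ᵇ []      _  = count-false (allPairs n)
  count-∈ᵇ (e ∷ L) nd with not (e ∈ᵇ L) in fresh | noDuplicates L in nd-L
  count-∈ᵇ (e ∷ L) refl | true | true =
    trans (count-∨ (λ z → does (z ≟² e)) (_∈ᵇ L) exclusive (allPairs n))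
          (cong₂ _+_ (count-allPairs-≟ e) (count-∈ᵇ L nd-L))
    where
    exclusive : ∀ z → does (z ≟² e) ∧ (z ∈ᵇ L) ≡ false
    exclusive z with z ≟² e
    ... | yes refl = not-true fresh
    ... | no _     = refl

  isEdge : SimpleGraph n → Fin n × Fin n → Bool
  isEdge G z = (toℕ (proj₁ z) <ᵇ toℕ (proj₂ z)) ∧ Adj G (proj₁ z) (proj₂ z)

  numEdges-by-list : {G : SimpleGraph n} (L : List (Fin n × Fin n)) →
    (∀ z → isEdge G z ≡ z ∈ᵇ L) → noDuplicates L ≡ true → numEdges G ≡ length L
  numEdges-by-list L listed nd = trans (count-ext listed (allPairs n)) (count-∈ᵇ L nd)

  numEdges-∪ : {G₁ G₂ : SimpleGraph n} → EdgeDisjoint G₁ G₂ →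
    numEdges (G₁ ∪ᴳ G₂) ≡ numEdges G₁ + numEdges G₂
  numEdges-∪ {G₁} {G₂} disjoint =
    trans (count-ext (λ (u , v) → ∧-distribˡ-∨ (toℕ u <ᵇ toℕ v) (Adj G₁ u v) (Adj G₂ u v)) (allPairs n))
          (count-∨ (isEdge G₁) (isEdge G₂) exclusive (allPairs n))
    where
    exclusive : ∀ z → isEdge G₁ z ∧ isEdge G₂ z ≡ false
    exclusive (u , v) with toℕ u <ᵇ toℕ v | Adj G₁ u v in e₁
    ... | false | _     = refl
    ... | true  | false = refl
    ... | true  | true  rewrite EdgeDisjoint.apart disjoint u v e₁ = refl

  ∅ᴳ : SimpleGraph n
  ∅ᴳ = record { Adj = λ _ _ → false ; sym = λ _ _ → refl ; irrefl = λ _ → refl }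

  numEdges-∅ : numEdges ∅ᴳ ≡ 0
  numEdges-∅ = trans (count-ext (λ z → ∧-zeroʳ _) (allPairs n)) (count-false (allPairs n))

-- Transport to a larger vertex set

<ᵇ-cong : ∀ {a b c d} → (a < b → c < d) → (c < d → a < b) → (a <ᵇ b) ≡ (c <ᵇ d)
<ᵇ-cong {a} {b} {c} {d} to from = ⇔→≡ {z = true} (mk⇔
  (λ e → Equivalence.to T-≡ (<⇒<ᵇ (to (<ᵇ⇒< a b (Equivalence.from T-≡ e)))))
  (λ e → Equivalence.to T-≡ (<⇒<ᵇ (from (<ᵇ⇒< c d (Equivalence.from T-≡ e))))))

module _ {K N : ℕ} (f : Fin K → Fin N) (monotone : ∀ a b → toℕ a < toℕ b → toℕ (f a) < toℕ (f b)) where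

  monotone-reflects : ∀ a b → toℕ (f a) < toℕ (f b) → toℕ a < toℕ b
  monotone-reflects a b fa<fb with <-cmp (toℕ a) (toℕ b)
  ... | tri< a<b _ _ = a<b
  ... | tri≈ _ a≡b _ = ⊥-elim (<-irrefl (cong (toℕ ∘ f) (toℕ-injective a≡b)) fa<fb)
  ... | tri> _ _ b<a = ⊥-elim (<-asym fa<fb (monotone b a b<a))

  monotone-injective : ∀ {a b} → f a ≡ f b → a ≡ b
  monotone-injective {a} {b} fa≡fb with <-cmp (toℕ a) (toℕ b)
  ... | tri< a<b _ _ = ⊥-elim (<-irrefl (cong toℕ fa≡fb) (monotone a b a<b))
  ... | tri≈ _ a≡b _ = toℕ-injective a≡b
  ... | tri> _ _ b<a = ⊥-elim (<-irrefl (cong toℕ (≡.sym fa≡fb)) (monotone b a b<a))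

  <ᵇ-monotone : ∀ a b → (toℕ (f a) <ᵇ toℕ (f b)) ≡ (toℕ a <ᵇ toℕ b)
  <ᵇ-monotone a b = <ᵇ-cong (monotone-reflects a b) (monotone a b)

record Placement {K N : ℕ} (ptK : Fin K → Fin K) (ptN : Fin N → Fin N) : Set where
  field
    ι : Fin K → Fin N
    back : Fin N → Maybe (Fin K)
    back-ι : ∀ x → back (ι x) ≡ just x
    ι-back : ∀ {y x} → back y ≡ just x → ι x ≡ y
    ι-partner : ∀ x → ptN (ι x) ≡ ι (ptK x)

  ι-injective : ∀ {a b} → ι a ≡ ι b → a ≡ b
  ι-injective {a} {b} e = just-injective (trans (≡.sym (back-ι a)) (trans (cong back e) (back-ι b)))
    where
    just-injective : ∀ {x y : Fin K} → just x ≡ just y → x ≡ y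
    just-injective refl = refl

  ι-image : ∀ y → (Σ (Fin K) λ a → ι a ≡ y) ⊎ back y ≡ nothing
  ι-image y with back y in e
  ... | just a  = inj₁ (a , ι-back e)
  ... | nothing = inj₂ refl

  outside-image : ∀ {y} → back y ≡ nothing → ∀ a → ι a ≢ y
  outside-image {y} e a refl with trans (≡.sym (back-ι a)) e
  ... | ()

module Transport {K N : ℕ} {ptK : Fin K → Fin K} {ptN : Fin N → Fin N}
  (ptN-involutive : ∀ y → ptN (ptN y) ≡ y) (P : Placement ptK ptN)
  {H : SimpleGraph K} (Q : MarkedQuad ptK H) where
  open Placement P
  private module Q = MarkedQuad Q

  private
    adjacentᴹ : Maybe (Fin K) → Maybe (Fin K) → Bool
    adjacentᴹ (just a) (just b) = Adj H a b
    adjacentᴹ _        _        = false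

    adjacentᴹ-sym : ∀ x y → adjacentᴹ x y ≡ adjacentᴹ y x
    adjacentᴹ-sym (just a) (just b) = sym H a b
    adjacentᴹ-sym (just a) nothing  = refl
    adjacentᴹ-sym nothing  (just b) = refl
    adjacentᴹ-sym nothing  nothing  = refl

    adjacentᴹ-irrefl : ∀ x → adjacentᴹ x x ≡ false
    adjacentᴹ-irrefl (just a) = irrefl H a
    adjacentᴹ-irrefl nothing  = refl

    rotationᴹ : Fin N → Maybe (Fin K) → Maybe (Fin K) → Fin N
    rotationᴹ z (just a) (just b) = ι (Q.ρ a b)
    rotationᴹ z _        _        = z

    activeᴹ : Maybe (Fin K) → Bool
    activeᴹ (just a) = Q.active a
    activeᴹ nothing  = false

    cornerᴹ : Fin N → Maybe (Fin K) → Fin N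
    cornerᴹ y (just a) = ι (Q.corner a)
    cornerᴹ y nothing  = y

  image : SimpleGraph N
  image = record
    { Adj    = λ y z → adjacentᴹ (back y) (back z)
    ; sym    = λ y z → adjacentᴹ-sym (back y) (back z)
    ; irrefl = λ y → adjacentᴹ-irrefl (back y) }

  rotation : Fin N → Fin N → Fin N
  rotation y z = rotationᴹ z (back y) (back z)

  active : Fin N → Bool
  active y = activeᴹ (back y)

  corner : Fin N → Fin N
  corner y = cornerᴹ y (back y)

  image-adjacent : ∀ a b → Adj image (ι a) (ι b) ≡ Adj H a b
  image-adjacent a b rewrite back-ι a | back-ι b = refl

  rotation-ι : ∀ a b → rotation (ι a) (ι b) ≡ ι (Q.ρ a b)
  rotation-ι a b rewrite back-ι a | back-ι b = refl

  active-ι : ∀ a → active (ι a) ≡ Q.active a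
  active-ι a rewrite back-ι a = refl

  corner-ι : ∀ a → corner (ι a) ≡ ι (Q.corner a)
  corner-ι a rewrite back-ι a = refl

  image-edge : ∀ y z → Adj image y z ≡ true →
    Σ (Fin K) λ a → Σ (Fin K) λ b → ι a ≡ y × ι b ≡ z × Adj H a b ≡ true
  image-edge y z e with back y in ey | back z in ez
  ... | just a  | just b  = a , b , ι-back ey , ι-back ez , e
  image-edge y z () | just _  | nothing
  image-edge y z () | nothing | _

  private
    iter-ι : ∀ a k x → iter (rotation (ι a)) k (ι x) ≡ ι (iter (Q.ρ a) k x)
    iter-ι a zero    x = refl
    iter-ι a (suc k) x = trans (cong (rotation (ι a)) (iter-ι a k x)) (rotation-ι a _)

    active-in-image : ∀ y → active y ≡ true → Σ (Fin K) λ a → ι a ≡ y × Q.active a ≡ true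
    active-in-image y e with back y in ey
    ... | just a = a , ι-back ey , e

  image-marked : MarkedQuad ptN image
  image-marked = record
    { ρ = rotation
    ; active = active
    ; inactive-isolated = inactive-isolated
    ; active-partner = active-partner
    ; ρ-closed = ρ-closed
    ; ρ-transitive = ρ-transitive
    ; quadrangular = quadrangular
    ; corner = corner
    ; corner-adjacent = corner-adjacent
    ; corner-face = corner-face
    ; corner-partner = corner-partner
    ; corner-far = corner-far
    }
    where
    inactive-isolated : ∀ y z → active y ≡ false → Adj image y z ≡ false
    inactive-isolated y z e with back y | back z
    ... | just a  | just b  = Q.inactive-isolated a b e
    ... | just _  | nothing = refl
    ... | nothing | _       = refl

    active-partner : ∀ y → active (ptN y) ≡ active y
    active-partner y with ι-image y
    ... | inj₁ (a , refl) =
      trans (cong active (ι-partner a)) (trans (active-ι (ptK a)) (trans (Q.active-partner a) (≡.sym (active-ι a))))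
    ... | inj₂ e with ι-image (ptN y)
    ...   | inj₂ e' rewrite e | e' = refl
    ...   | inj₁ (b , eb) = ⊥-elim (outside-image e (ptK b)
            (trans (≡.sym (ι-partner b)) (trans (cong ptN eb) (ptN-involutive y))))

    ρ-closed : ∀ y z → Adj image y z ≡ true → Adj image y (rotation y z) ≡ true
    ρ-closed y z e with image-edge y z e
    ... | a , b , refl , refl , ab rewrite rotation-ι a b | image-adjacent a (Q.ρ a b) = Q.ρ-closed a b ab

    ρ-transitive : ∀ y z w → Adj image y z ≡ true → Adj image y w ≡ true → Reachable (rotation y) z w
    ρ-transitive y z w e e' with image-edge y z e | image-edge y w e'
    ... | a , b , refl , refl , ab | a' , c , a'≡a , refl , a'c with ι-injective a'≡a
    ...   | refl with Q.ρ-transitive a b c ab a'c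
    ...     | k , hit = k , trans (iter-ι a k b) (cong ι hit)

    quadrangular : Quadrangular image rotation
    quadrangular y z e with image-edge y z e
    ... | a , b , refl , refl , ab =
      square-face-ab (square-map ι ι-injective rotation-ι (Q.edge-square a b ab))

    corner-adjacent : ∀ y → active y ≡ true → Adj image y (corner y) ≡ true
    corner-adjacent y e with active-in-image y e
    ... | a , refl , act rewrite corner-ι a | image-adjacent a (Q.corner a) = Q.corner-adjacent a act

    corner-face : ∀ y → active y ≡ true → rotation (rotation y (corner y)) y ≡ ptN y
    corner-face y e with active-in-image y e
    ... | a , refl , act rewrite corner-ι a | rotation-ι a (Q.corner a) | rotation-ι (Q.ρ a (Q.corner a)) a
                               | ι-partner a = cong ι (Q.corner-face a act)

    corner-partner : ∀ y → active y ≡ true → corner (ptN y) ≡ rotation y (corner y)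
    corner-partner y e with active-in-image y e
    ... | a , refl , act rewrite ι-partner a | corner-ι (ptK a) | corner-ι a | rotation-ι a (Q.corner a) =
      cong ι (Q.corner-partner a act)

    corner-far : ∀ y → active y ≡ true → corner (rotation y (corner y)) ≢ y
    corner-far y e with active-in-image y e
    ... | a , refl , act rewrite corner-ι a | rotation-ι a (Q.corner a) | corner-ι (Q.ρ a (Q.corner a)) =
      Q.corner-far a act ∘ ι-injective

  private
    ι² : Fin K × Fin K → Fin N × Fin N
    ι² (a , b) = ι a , ι b

    does-ι : ∀ a b → does (ι a Fin.≟ ι b) ≡ does (a Fin.≟ b)
    does-ι a b with a Fin.≟ b | ι a Fin.≟ ι b
    ... | yes _    | yes _ = refl
    ... | no _     | no _  = refl
    ... | yes refl | no ne = ⊥-elim (ne refl)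
    ... | no ne    | yes e = ⊥-elim (ne (ι-injective e))

    ∈ᵇ-map-ι : ∀ z L → ι² z ∈ᵇ map ι² L ≡ z ∈ᵇ L
    ∈ᵇ-map-ι z [] = refl
    ∈ᵇ-map-ι (a , b) ((c , d) ∷ L) = cong₂ _∨_
      (trans (does-≟² (ι a) (ι b) (ι c) (ι d))
        (trans (cong₂ _∧_ (does-ι a c) (does-ι b d)) (≡.sym (does-≟² a b c d))))
      (∈ᵇ-map-ι (a , b) L)

    noDuplicates-map-ι : ∀ L → noDuplicates (map ι² L) ≡ noDuplicates L
    noDuplicates-map-ι [] = refl
    noDuplicates-map-ι (e ∷ L) = cong₂ (λ x y → Data.Bool.not x ∧ y) (∈ᵇ-map-ι e L) (noDuplicates-map-ι L)

    ∈ᵇ-map-outside : ∀ y z L → (∀ a b → does (y Fin.≟ ι a) ∧ does (z Fin.≟ ι b) ≡ false) →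
      (y , z) ∈ᵇ map ι² L ≡ false
    ∈ᵇ-map-outside y z [] _ = refl
    ∈ᵇ-map-outside y z ((a , b) ∷ L) outside =
      cong₂ _∨_ (trans (does-≟² y z (ι a) (ι b)) (outside a b)) (∈ᵇ-map-outside y z L outside)

    does-outside : ∀ {y} → back y ≡ nothing → ∀ a → does (y Fin.≟ ι a) ≡ false
    does-outside {y} e a with y Fin.≟ ι a
    ... | yes eq = ⊥-elim (outside-image e a (≡.sym eq))
    ... | no _   = refl

  numEdges-image : (∀ a b → toℕ a < toℕ b → toℕ (ι a) < toℕ (ι b)) →
    (L : List (Fin K × Fin K)) → (∀ z → isEdge H z ≡ z ∈ᵇ L) → noDuplicates L ≡ true →
    numEdges image ≡ length L
  numEdges-image monotone L listed nd =
    trans (numEdges-by-list {G = image} (map ι² L) listed-image (trans (noDuplicates-map-ι L) nd)) (length-map ι² L)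
    where
    listed-image : ∀ z → isEdge image z ≡ z ∈ᵇ map ι² L
    listed-image (y , z) with ι-image y | ι-image z
    ... | inj₂ e | _ rewrite e =
      trans (∧-zeroʳ _) (≡.sym (∈ᵇ-map-outside y z L λ a b → cong (_∧ _) (does-outside e a)))
    ... | inj₁ (a , refl) | inj₂ e rewrite back-ι a | e =
      trans (∧-zeroʳ _) (≡.sym (∈ᵇ-map-outside (ι a) z L λ a' b → trans (cong (_ ∧_) (does-outside e b)) (∧-zeroʳ _)))
    ... | inj₁ (a , refl) | inj₁ (b , refl) =
      trans (cong₂ _∧_ (<ᵇ-monotone ι monotone a b) (image-adjacent a b))
            (trans (listed (a , b)) (≡.sym (∈ᵇ-map-ι (a , b) L)))

-- The building blocks C4 and K8

module DecideGraph {K : ℕ} (A : Fin K → Fin K → Bool) where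

  symmetric? : Dec (∀ u v → A u v ≡ A v u)
  symmetric? = all? λ u → all? λ v → A u v ≟ᵇ A v u

  irreflexive? : Dec (∀ v → A v v ≡ false)
  irreflexive? = all? λ v → A v v ≟ᵇ false

  graph : True symmetric? → True irreflexive? → SimpleGraph K
  graph s i = record { Adj = A ; sym = toWitness s ; irrefl = toWitness i }

module DecideMarked {K : ℕ} (pt : Fin K → Fin K) (H : SimpleGraph K)
  (ρ : Fin K → Fin K → Fin K) (corner : Fin K → Fin K) where

  private
    _≢?_ : (a b : Fin K) → Dec (a ≢ b)
    a ≢? b = ¬? (a Fin.≟ b)

    distinct4? : (a b c d : Fin K) → Dec (Distinct4 a b c d)
    distinct4? a b c d = a ≢? b ×-dec a ≢? c ×-dec a ≢? d ×-dec b ≢? c ×-dec b ≢? d ×-dec c ≢? d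

  ClosesSquare : Fin K → Fin K → Set
  ClosesSquare a b = let c = ρ b a ; d = ρ c b in ρ d c ≡ a × ρ a d ≡ b × Distinct4 a b c d

  quadrangular? : Dec (∀ a b → Adj H a b ≡ true → ClosesSquare a b)
  quadrangular? = all? λ a → all? λ b → (Adj H a b ≟ᵇ true) →-dec
    (let c = ρ b a ; d = ρ c b in (ρ d c Fin.≟ a) ×-dec (ρ a d Fin.≟ b) ×-dec distinct4? a b c d)

  closed? : Dec (∀ v u → Adj H v u ≡ true → Adj H v (ρ v u) ≡ true)
  closed? = all? λ v → all? λ u → (Adj H v u ≟ᵇ true) →-dec (Adj H v (ρ v u) ≟ᵇ true)

  BoundedReach : Set
  BoundedReach = ∀ v u w → Adj H v u ≡ true → Adj H v w ≡ true →
    Σ (Fin K) λ k → iter (ρ v) (toℕ k) u ≡ w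

  transitive? : Dec BoundedReach
  transitive? = all? λ v → all? λ u → all? λ w → (Adj H v u ≟ᵇ true) →-dec ((Adj H v w ≟ᵇ true) →-dec
    any? λ (k : Fin K) → iter (ρ v) (toℕ k) u Fin.≟ w)

  MarkedCorner : Fin K → Set
  MarkedCorner v = Adj H v (corner v) ≡ true × ρ (ρ v (corner v)) v ≡ pt v ×
    corner (pt v) ≡ ρ v (corner v) × corner (ρ v (corner v)) ≢ v

  corners? : Dec (∀ v → MarkedCorner v)
  corners? = all? λ v → (Adj H v (corner v) ≟ᵇ true) ×-dec (ρ (ρ v (corner v)) v Fin.≟ pt v) ×-dec
    (corner (pt v) Fin.≟ ρ v (corner v)) ×-dec (corner (ρ v (corner v)) ≢? v)

  marked : True quadrangular? → True closed? → True transitive? → True corners? → MarkedQuad pt H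
  marked q c t m = record
    { ρ = ρ
    ; active = λ _ → true
    ; inactive-isolated = λ _ _ ()
    ; active-partner = λ _ → refl
    ; ρ-closed = toWitness c
    ; ρ-transitive = λ v u w e e' → let (k , hit) = toWitness t v u w e e' in toℕ k , hit
    ; quadrangular = λ a b e → let (d-turn , a-turn , distinct) = toWitness q a b e in
        square-face-ab (record { b-turn = refl ; c-turn = refl ; d-turn = d-turn ; a-turn = a-turn
                                ; distinct = distinct })
    ; corner = corner
    ; corner-adjacent = λ v _ → proj₁ (toWitness m v)
    ; corner-face = λ v _ → proj₁ (proj₂ (toWitness m v))
    ; corner-partner = λ v _ → proj₁ (proj₂ (proj₂ (toWitness m v)))
    ; corner-far = λ v _ → proj₂ (proj₂ (proj₂ (toWitness m v)))
    }

module _ {n : ℕ} (G : SimpleGraph n) where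

  edgeList : List (Fin n × Fin n)
  edgeList = filterᵇ (isEdge G) (allPairs n)

  edgeList? : Dec (∀ a b → isEdge G (a , b) ≡ (a , b) ∈ᵇ edgeList)
  edgeList? = all? λ a → all? λ b → isEdge G (a , b) ≟ᵇ ((a , b) ∈ᵇ edgeList)

-- Fin (2 + 2) = {L 0, L 1, R 0, R 1}; the 4-cycle L 0, L 1, R 0, R 1 joins the two pairs.
C4 : SimpleGraph (2 + 2)
C4 = DecideGraph.graph (λ u v → not (does (Pairing.index 2 u Fin.≟ Pairing.index 2 v))) tt tt

C4-marked : MarkedQuad (Pairing.partner 2) C4
C4-marked = DecideMarked.marked (Pairing.partner 2) C4 (λ _ u → Pairing.partner 2 u)
  (lookup (# 3 ∷ # 2 ∷ # 1 ∷ # 0 ∷ [])) tt tt tt tt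

K8 : SimpleGraph (4 + 4)
K8 = DecideGraph.graph (λ u v → not (does (u Fin.≟ v))) tt tt

-- Row v lists ρ v u for u = 0, …, 7 (the diagonal entry is unused): a quadrangular embedding of
-- K8 with 14 faces, in the orientable surface of genus 4.
K8-rotation : Vec (Vec (Fin 8) 8) 8
K8-rotation =
  (# 0 ∷ # 7 ∷ # 5 ∷ # 1 ∷ # 3 ∷ # 4 ∷ # 2 ∷ # 6 ∷ []) ∷
  (# 4 ∷ # 1 ∷ # 5 ∷ # 0 ∷ # 7 ∷ # 6 ∷ # 3 ∷ # 2 ∷ []) ∷
  (# 3 ∷ # 5 ∷ # 2 ∷ # 1 ∷ # 0 ∷ # 6 ∷ # 7 ∷ # 4 ∷ []) ∷
  (# 7 ∷ # 5 ∷ # 6 ∷ # 3 ∷ # 0 ∷ # 2 ∷ # 4 ∷ # 1 ∷ []) ∷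
  (# 6 ∷ # 3 ∷ # 1 ∷ # 7 ∷ # 4 ∷ # 2 ∷ # 5 ∷ # 0 ∷ []) ∷
  (# 4 ∷ # 3 ∷ # 7 ∷ # 6 ∷ # 2 ∷ # 5 ∷ # 0 ∷ # 1 ∷ []) ∷
  (# 2 ∷ # 7 ∷ # 4 ∷ # 0 ∷ # 5 ∷ # 1 ∷ # 6 ∷ # 3 ∷ []) ∷
  (# 3 ∷ # 2 ∷ # 0 ∷ # 4 ∷ # 6 ∷ # 1 ∷ # 5 ∷ # 7 ∷ []) ∷ []

K8-marked : MarkedQuad (Pairing.partner 4) K8
K8-marked = DecideMarked.marked (Pairing.partner 4) K8 (λ v u → lookup (lookup K8-rotation v) u)
  (lookup (# 3 ∷ # 7 ∷ # 0 ∷ # 6 ∷ # 1 ∷ # 2 ∷ # 3 ∷ # 4 ∷ [])) tt tt tt tt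

-- The pairs of a graph on Fin (d + d) are sent to the pairs f 0 < f 1 < … < f (d - 1) of Fin (m + m).
module Placing (m d : ℕ) (f : Fin d → ℕ)
  (f-monotone : ∀ a b → toℕ a < toℕ b → f a < f b) (f<m : ∀ j → f j < m) where
  open Pairing m
  private module Small = Pairing d

  pos : Fin d → Fin m
  pos j = fromℕ< (f<m j)

  toℕ-pos : ∀ j → toℕ (pos j) ≡ f j
  toℕ-pos j = toℕ-fromℕ< (f<m j)

  pos-monotone : ∀ a b → toℕ a < toℕ b → toℕ (pos a) < toℕ (pos b)
  pos-monotone a b a<b rewrite toℕ-pos a | toℕ-pos b = f-monotone a b a<b

  pos-injective : ∀ {a b} → pos a ≡ pos b → a ≡ b
  pos-injective = monotone-injective pos pos-monotone

  private
    find : Fin m → Maybe (Fin d)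
    find i with any? (λ j → pos j Fin.≟ i)
    ... | yes (j , _) = just j
    ... | no _        = nothing

    find-pos : ∀ j → find (pos j) ≡ just j
    find-pos j with any? (λ k → pos k Fin.≟ pos j)
    ... | yes (k , e) = cong just (pos-injective e)
    ... | no none     = ⊥-elim (none (j , refl))

    find-just : ∀ {i j} → find i ≡ just j → pos j ≡ i
    find-just {i} e with any? (λ k → pos k Fin.≟ i)
    find-just refl | yes (k , e) = e

  ι : Fin (d + d) → Fin (m + m)
  ι x = [ L ∘ pos , R ∘ pos ]′ (splitAt d x)

  back : Fin (m + m) → Maybe (Fin (d + d))
  back y = [ Maybe.map (_↑ˡ d) ∘ find , Maybe.map (d ↑ʳ_) ∘ find ]′ (splitAt m y)

  ι-L : ∀ j → ι (Small.L j) ≡ L (pos j)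
  ι-L j rewrite splitAt-↑ˡ d j d = refl

  ι-R : ∀ j → ι (Small.R j) ≡ R (pos j)
  ι-R j rewrite splitAt-↑ʳ d d j = refl

  back-L : ∀ i → back (L i) ≡ Maybe.map (_↑ˡ d) (find i)
  back-L i rewrite splitAt-↑ˡ m i m = refl

  back-R : ∀ i → back (R i) ≡ Maybe.map (d ↑ʳ_) (find i)
  back-R i rewrite splitAt-↑ʳ m m i = refl

  placement : Placement Small.partner partner
  placement = record
    { ι = ι ; back = back ; back-ι = back-ι ; ι-back = ι-back ; ι-partner = ι-partner }
    where
    back-ι : ∀ x → back (ι x) ≡ just x
    back-ι x with view {d} x
    ... | left j  rewrite ι-L j | back-L (pos j) | find-pos j = refl
    ... | right j rewrite ι-R j | back-R (pos j) | find-pos j = refl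

    ι-back : ∀ {y x} → back y ≡ just x → ι x ≡ y
    ι-back {y} {x} e with view {m} y
    ... | left i  = from-left (trans (≡.sym (back-L i)) e)
      where
      from-left : Maybe.map (_↑ˡ d) (find i) ≡ just x → ι x ≡ L i
      from-left e with find i in found
      from-left refl | just j = trans (ι-L j) (cong L (find-just found))
    ... | right i = from-right (trans (≡.sym (back-R i)) e)
      where
      from-right : Maybe.map (d ↑ʳ_) (find i) ≡ just x → ι x ≡ R i
      from-right e with find i in found
      from-right refl | just j = trans (ι-R j) (cong R (find-just found))

    ι-partner : ∀ x → partner (ι x) ≡ ι (Small.partner x)
    ι-partner x with view {d} x
    ... | left j  rewrite ι-L j | Small.partner-L j | ι-R j = partner-L (pos j)
    ... | right j rewrite ι-R j | Small.partner-R j | ι-L j = partner-R (pos j)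

  ι-monotone : ∀ a b → toℕ a < toℕ b → toℕ (ι a) < toℕ (ι b)
  ι-monotone a b a<b with view {d} a | view {d} b
  ... | left i | left j
    rewrite ι-L i | ι-L j | toℕ-↑ˡ (pos i) m | toℕ-↑ˡ (pos j) m | toℕ-↑ˡ i d | toℕ-↑ˡ j d =
    pos-monotone i j a<b
  ... | left i | right j
    rewrite ι-L i | ι-R j | toℕ-↑ˡ (pos i) m | toℕ-↑ʳ m (pos j) =
    <-≤-trans (toℕ<n (pos i)) (m≤m+n m (toℕ (pos j)))
  ... | right i | left j
    rewrite toℕ-↑ʳ d i | toℕ-↑ˡ j d = ⊥-elim (<-asym a<b (<-≤-trans (toℕ<n j) (m≤m+n d (toℕ i))))
  ... | right i | right j
    rewrite ι-R i | ι-R j | toℕ-↑ʳ m (pos i) | toℕ-↑ʳ m (pos j) | toℕ-↑ʳ d i | toℕ-↑ʳ d j =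
    +-monoʳ-< m (pos-monotone i j (+-cancelˡ-< d (toℕ i) (toℕ j) a<b))

  index-ι : ∀ a → toℕ (index (ι a)) ≡ f (Small.index a)
  index-ι a with view {d} a
  ... | left j  rewrite ι-L j | Small.index-L j | index-L (pos j) = toℕ-pos j
  ... | right j rewrite ι-R j | Small.index-R j | index-R (pos j) = toℕ-pos j

  ι-onto-pair : ∀ y j → toℕ (index y) ≡ f j → Σ (Fin (d + d)) λ a → ι a ≡ y × Small.index a ≡ j
  ι-onto-pair y j e with view {m} y
  ... | left i  = Small.L j , trans (ι-L j) (cong L (pos-at (index-L i))) , Small.index-L j
    where
    pos-at : ∀ {i} → index y ≡ i → pos j ≡ i
    pos-at refl = toℕ-injective (trans (toℕ-pos j) (≡.sym e))
  ... | right i = Small.R j , trans (ι-R j) (cong R (pos-at (index-R i))) , Small.index-R j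
    where
    pos-at : ∀ {i} → index y ≡ i → pos j ≡ i
    pos-at refl = toℕ-injective (trans (toℕ-pos j) (≡.sym e))

InBlock : ℕ → ℕ → Set
InBlock h p = 4 * h ≤ p × p < 4 * h + 4

Between : ℕ → ℕ → ℕ → ℕ → Set
Between i k p q = (p ≡ i × q ≡ k) ⊎ (p ≡ k × q ≡ i)

module Layout (m : ℕ) where
  open Pairing m public

  P : Fin (m + m) → ℕ
  P y = toℕ (index y)

  record MarkedGraph : Set where
    constructor marked-graph
    field
      graph  : SimpleGraph (m + m)
      marked : MarkedQuad partner graph
  open MarkedGraph public

  _⊆_ : MarkedGraph → MarkedGraph → Set
  A ⊆ B = ∀ y z → Adj (graph A) y z ≡ true → Adj (graph B) y z ≡ true

  Covers : MarkedGraph → (ℕ → ℕ → Set) → Set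
  Covers A X = ∀ y z → Adj (graph A) y z ≡ true → X (P y) (P z)

  empty : MarkedGraph
  empty = marked-graph ∅ᴳ (record
    { ρ = λ _ u → u ; active = λ _ → false ; inactive-isolated = λ _ _ _ → refl
    ; active-partner = λ _ → refl ; ρ-closed = λ _ _ () ; ρ-transitive = λ _ _ _ ()
    ; quadrangular = λ _ _ () ; corner = λ v → v ; corner-adjacent = λ _ ()
    ; corner-face = λ _ () ; corner-partner = λ _ () ; corner-far = λ _ () })

  covers-disjoint : ∀ {A B X Y} → Covers A X → Covers B Y → (∀ {p q} → X p q → Y p q → ⊥) →
    EdgeDisjoint (graph A) (graph B)
  covers-disjoint {A} {B} cA cB apart = edge-disjoint λ y z e →
    ¬-not λ e' → apart (cA y z e) (cB y z e')

  merge : (A B : MarkedGraph) → EdgeDisjoint (graph A) (graph B) → MarkedGraph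
  merge A B disjoint = marked-graph (graph A ∪ᴳ graph B)
    (Amalgamation.amalgam isLeft isLeft-partner (marked A) (marked B) disjoint)

  module _ (A B : MarkedGraph) (disjoint : EdgeDisjoint (graph A) (graph B)) where

    merge-numEdges : numEdges (graph (merge A B disjoint)) ≡ numEdges (graph A) + numEdges (graph B)
    merge-numEdges = numEdges-∪ disjoint

    ⊆-mergeˡ : A ⊆ merge A B disjoint
    ⊆-mergeˡ y z e = ∨-introˡ e

    ⊆-mergeʳ : B ⊆ merge A B disjoint
    ⊆-mergeʳ y z e = ∨-introʳ e

  module C4-piece {i k : ℕ} (i<k : i < k) (k<m : k < m) where
    private
      f : Fin 2 → ℕ
      f zero       = i
      f (suc zero) = k

      f-monotone : ∀ a b → toℕ a < toℕ b → f a < f b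
      f-monotone zero       (suc zero) _ = i<k
      f-monotone (suc zero) (suc zero) (s≤s ())

      f<m : ∀ j → f j < m
      f<m zero       = <-trans i<k k<m
      f<m (suc zero) = k<m

      open Placing m 2 f f-monotone f<m
      module T = Transport partner-involutive placement C4-marked

      between : (a b : Fin 2) → not (does (a Fin.≟ b)) ≡ true → Between i k (f a) (f b)
      between zero       zero       ()
      between zero       (suc zero) _ = inj₁ (refl , refl)
      between (suc zero) zero       _ = inj₂ (refl , refl)
      between (suc zero) (suc zero) ()

    c4 : MarkedGraph
    c4 = marked-graph T.image T.image-marked

    c4-numEdges : numEdges (graph c4) ≡ 4
    c4-numEdges = T.numEdges-image ι-monotone (edgeList C4)
      (λ (a , b) → toWitness {a? = edgeList? C4} tt a b) refl

    c4-covers : Covers c4 (Between i k)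
    c4-covers y z e with T.image-edge y z e
    ... | a , b , refl , refl , ab =
      Sum.map (λ (p , q) → trans (index-ι a) p , trans (index-ι b) q)
              (λ (p , q) → trans (index-ι a) p , trans (index-ι b) q)
              (between (Pairing.index 2 a) (Pairing.index 2 b) ab)

    c4-complete : ∀ y z → P y ≡ i → P z ≡ k → Adj (graph c4) y z ≡ true
    c4-complete y z Py Pz with ι-onto-pair y zero Py | ι-onto-pair z (suc zero) Pz
    ... | a , refl , a₀ | b , refl , b₁ = trans (T.image-adjacent a b)
      (subst₂ (λ x y → not (does (x Fin.≟ y)) ≡ true) (≡.sym a₀) (≡.sym b₁) refl)

  module K8-piece {h : ℕ} (fits : 4 * h + 4 ≤ m) where
    private
      f : Fin 4 → ℕ
      f j = 4 * h + toℕ j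

      f-monotone : ∀ a b → toℕ a < toℕ b → f a < f b
      f-monotone a b = +-monoʳ-< (4 * h)

      f<m : ∀ j → f j < m
      f<m j = <-≤-trans (+-monoʳ-< (4 * h) (toℕ<n j)) fits

      open Placing m 4 f f-monotone f<m
      module T = Transport partner-involutive placement K8-marked

      in-block : ∀ j → InBlock h (f j)
      in-block j = m≤m+n (4 * h) (toℕ j) , +-monoʳ-< (4 * h) (toℕ<n j)

      block-offset : ∀ {p} → InBlock h p → Σ (Fin 4) λ j → f j ≡ p
      block-offset {p} (lower , upper) = fromℕ< offset<4 ,
        trans (cong (4 * h +_) (toℕ-fromℕ< offset<4)) (m+[n∸m]≡n lower)
        where
        offset<4 : p ∸ 4 * h < 4
        offset<4 = subst (p ∸ 4 * h <_) (m+n∸m≡n (4 * h) 4) (∸-monoˡ-< upper lower)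

    k8 : MarkedGraph
    k8 = marked-graph T.image T.image-marked

    k8-numEdges : numEdges (graph k8) ≡ 28
    k8-numEdges = T.numEdges-image ι-monotone (edgeList K8)
      (λ (a , b) → toWitness {a? = edgeList? K8} tt a b) refl

    k8-covers : Covers k8 (λ p q → InBlock h p × InBlock h q)
    k8-covers y z e with T.image-edge y z e
    ... | a , b , refl , refl , _ =
      subst (InBlock h) (≡.sym (index-ι a)) (in-block _) , subst (InBlock h) (≡.sym (index-ι b)) (in-block _)

    k8-complete : ∀ y z → InBlock h (P y) → InBlock h (P z) → y ≢ z → Adj (graph k8) y z ≡ true
    k8-complete y z y-in z-in y≢z with block-offset y-in | block-offset z-in
    ... | j , fj | j' , fj' with ι-onto-pair y j (≡.sym fj) | ι-onto-pair z j' (≡.sym fj')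
    ...   | a , refl , _ | b , refl , _ =
      trans (T.image-adjacent a b) (cong not (dec-false (a Fin.≟ b) λ a≡b → y≢z (cong ι a≡b)))

-- Assembling the graph

SameBlock : ℕ → ℕ → ℕ → Set
SameBlock g p q = Σ ℕ λ h → h < g × InBlock h p × InBlock h q

-- (p, q) with p < q precedes (i, k) in the order in which the 4-cycles are added: by q, then by p.
Before : ℕ → ℕ → ℕ → ℕ → Set
Before k i p q = p < q × (q < k ⊎ (q ≡ k × p < i))

Done : ℕ → ℕ → ℕ → ℕ → ℕ → Set
Done g k i p q = SameBlock g p q ⊎ Before k i p q ⊎ Before k i q p

4*suc : ∀ h → 4 * suc h ≡ 4 * h + 4
4*suc h = trans (*-suc 4 h) (+-comm 4 (4 * h))

block-order : ∀ {h h' p p'} → InBlock h p → InBlock h' p' → h < h' → p < p'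
block-order {h} {h'} (_ , p<) (h'≤ , _) h<h' =
  <-≤-trans p< (≤-trans (subst (_≤ 4 * h') (4*suc h) (*-monoʳ-≤ 4 h<h')) h'≤)

block-unique : ∀ {h h' p} → InBlock h p → InBlock h' p → h ≡ h'
block-unique {h} {h'} b b' with <-cmp h h'
... | tri< h<h' _ _ = ⊥-elim (<-irrefl refl (block-order b b' h<h'))
... | tri≈ _ h≡h' _ = h≡h'
... | tri> _ _ h'<h = ⊥-elim (<-irrefl refl (block-order b' b h'<h))

zero-or-positive : ∀ n → n ≡ 0 ⊎ 0 < n
zero-or-positive zero    = inj₁ refl
zero-or-positive (suc n) = inj₂ (s≤s z≤n)

<-or-≥ : ∀ p q → p < q ⊎ q ≤ p
<-or-≥ p q with <-cmp p q
... | tri< p<q _ _ = inj₁ p<q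
... | tri≈ _ p≡q _ = inj₂ (≤-reflexive (≡.sym p≡q))
... | tri> _ _ q<p = inj₂ (<⇒≤ q<p)

below-or-in-block : ∀ g q → q < 4 * suc g → q < 4 * g ⊎ InBlock g q
below-or-in-block g q q< with <-cmp q (4 * g)
... | tri< q<4g _ _ = inj₁ q<4g
... | tri≈ _ q≡4g _ = inj₂ (subst (4 * g ≤_) (≡.sym q≡4g) ≤-refl , subst (q <_) (4*suc g) q<)
... | tri> _ _ q>4g = inj₂ (<⇒≤ q>4g , subst (q <_) (4*suc g) q<)

before-weaken : ∀ {k i i' p q} → i ≤ i' → Before k i p q → Before k i' p q
before-weaken i≤i' (p<q , inj₁ q<k)          = p<q , inj₁ q<k
before-weaken i≤i' (p<q , inj₂ (q≡k , p<i)) = p<q , inj₂ (q≡k , <-≤-trans p<i i≤i')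

before-next-row : ∀ {k i p q} → Before k i p q → Before (suc k) 0 p q
before-next-row (p<q , inj₁ q<k)           = p<q , inj₁ (m≤n⇒m≤1+n q<k)
before-next-row (p<q , inj₂ (refl , _)) = p<q , inj₁ ≤-refl

done-map : ∀ {g k i g' k' i'} → g ≤ g' → (∀ {p q} → Before k i p q → Before k' i' p q) →
  ∀ {p q} → Done g k i p q → Done g' k' i' p q
done-map g≤g' f (inj₁ (h , h<g , bp , bq)) = inj₁ (h , <-≤-trans h<g g≤g' , bp , bq)
done-map g≤g' f (inj₂ (inj₁ b))            = inj₂ (inj₁ (f b))
done-map g≤g' f (inj₂ (inj₂ b))            = inj₂ (inj₂ (f b))

between-sym : ∀ {i k p q} → Between i k p q → Between i k q p
between-sym (inj₁ (p≡i , q≡k)) = inj₂ (q≡k , p≡i)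
between-sym (inj₂ (p≡k , q≡i)) = inj₁ (q≡i , p≡k)

between-not-before : ∀ {k i p q} → i < k → Between i k p q → ¬ Before k i p q
between-not-before i<k (inj₁ (refl , refl)) (_ , inj₁ k<k)       = <-irrefl refl k<k
between-not-before i<k (inj₁ (refl , refl)) (_ , inj₂ (_ , i<i)) = <-irrefl refl i<i
between-not-before i<k (inj₂ (refl , refl)) (k<i , _)           = <-asym i<k k<i

between-fresh : ∀ {g k i} → i < k → ¬ SameBlock g i k → ∀ {p q} → Done g k i p q → Between i k p q → ⊥
between-fresh i<k apart (inj₁ same) (inj₁ (refl , refl))              = apart same
between-fresh i<k apart (inj₁ (h , h<g , bk , bi)) (inj₂ (refl , refl)) = apart (h , h<g , bi , bk)
between-fresh i<k apart (inj₂ (inj₁ b)) across = between-not-before i<k across b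
between-fresh i<k apart (inj₂ (inj₂ b)) across = between-not-before i<k (between-sym across) b

between-done : ∀ {g k i p q} → i < k → Between i k p q → Done g k (suc i) p q
between-done i<k (inj₁ (refl , refl)) = inj₂ (inj₁ (i<k , inj₂ (refl , ≤-refl)))
between-done i<k (inj₂ (refl , refl)) = inj₂ (inj₂ (i<k , inj₂ (refl , ≤-refl)))

block-fresh : ∀ {h p q} → Done h (4 * h) 0 p q → InBlock h p × InBlock h q → ⊥
block-fresh {h} (inj₁ (h' , h'<h , bp , _)) (bp' , _) = <-irrefl (block-unique {h'} {h} bp bp') h'<h
block-fresh (inj₂ (inj₁ (_ , inj₁ q<4h))) (_ , (4h≤q , _)) = <-irrefl refl (<-≤-trans q<4h 4h≤q)
block-fresh (inj₂ (inj₂ (_ , inj₁ p<4h))) ((4h≤p , _) , _) = <-irrefl refl (<-≤-trans p<4h 4h≤p)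
block-fresh (inj₂ (inj₁ (_ , inj₂ (_ , ())))) _
block-fresh (inj₂ (inj₂ (_ , inj₂ (_ , ())))) _

sumFrom : (ℕ → ℕ) → ℕ → ℕ → ℕ
sumFrom f k zero    = 0
sumFrom f k (suc n) = f k + sumFrom f (suc k) n

Tri : ℕ → ℕ
Tri zero    = 0
Tri (suc n) = Tri n + n

Tri-C : ∀ n → n C 2 ≡ Tri n
Tri-C zero    = refl
Tri-C (suc n) = trans (≡.sym (nCk+nC[k+1]≡[n+1]C[k+1] n 1)) (trans (cong₂ _+_ (nC1≡n n) (Tri-C n)) (+-comm n (Tri n)))

Tri-+ : ∀ a b → Tri (a + b) ≡ Tri a + Tri b + a * b
Tri-+ a zero    rewrite +-identityʳ a = pad (Tri a) a
  where
  pad : ∀ t a → t ≡ t + 0 + a * 0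
  pad = solve-∀
Tri-+ a (suc b) = begin
  Tri (a + suc b)                    ≡⟨ cong Tri (+-suc a b) ⟩
  Tri (a + b) + (a + b)              ≡⟨ cong (_+ (a + b)) (Tri-+ a b) ⟩
  Tri a + Tri b + a * b + (a + b)    ≡⟨ rearrange (Tri a) (Tri b) a b ⟩
  Tri a + (Tri b + b) + a * suc b    ∎
  where
  open ≡.≡-Reasoning
  rearrange : ∀ x y a b → x + y + a * b + (a + b) ≡ x + (y + b) + a * suc b
  rearrange = solve-∀

sumFrom-id : ∀ k n → sumFrom (λ q → q) k n + Tri k ≡ Tri (k + n)
sumFrom-id k zero    = cong Tri (≡.sym (+-identityʳ k))
sumFrom-id k (suc n) = begin
  k + sumFrom (λ q → q) (suc k) n + Tri k      ≡⟨ rearrange k (sumFrom (λ q → q) (suc k) n) (Tri k) ⟩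
  sumFrom (λ q → q) (suc k) n + (Tri k + k)    ≡⟨ sumFrom-id (suc k) n ⟩
  Tri (suc k + n)                              ≡⟨ cong Tri (+-suc k n) ⟨
  Tri (k + suc n)                              ∎
  where
  open ≡.≡-Reasoning
  rearrange : ∀ k s t → k + s + t ≡ s + (t + k)
  rearrange = solve-∀

module Assembly (m : ℕ) where
  open Layout m

  Joined : MarkedGraph → ℕ → ℕ → Set
  Joined S p q = ∀ y z → P y ≡ p → P z ≡ q → Adj (graph S) y z ≡ true

  record Extension (S : MarkedGraph) (X : ℕ → ℕ → Set) (added : ℕ) : Set where
    constructor extension
    field
      result : MarkedGraph
      covers : Covers result X
      numEdges-result : numEdges (graph result) ≡ numEdges (graph S) + added
      grows : S ⊆ result
  open Extension public

  ⊆-trans : ∀ {A B C} → A ⊆ B → B ⊆ C → A ⊆ C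
  ⊆-trans A⊆B B⊆C y z e = B⊆C y z (A⊆B y z e)

  c4-row : ∀ g k i n → k < m → i + n ≤ k → (∀ j → i ≤ j → j < i + n → ¬ SameBlock g j k) →
    ∀ S → Covers S (Done g k i) →
    Σ (Extension S (Done g k (i + n)) (4 * n)) λ E → ∀ j → i ≤ j → j < i + n → Joined (result E) j k
  c4-row g k i zero k<m _ _ S covered =
    extension S (subst (λ x → Covers S (Done g k x)) (≡.sym (+-identityʳ i)) covered)
      (≡.sym (+-identityʳ _)) (λ _ _ e → e) ,
    λ j i≤j j<i+0 → ⊥-elim (<-irrefl refl (<-≤-trans (subst (j <_) (+-identityʳ i) j<i+0) i≤j))
  c4-row g k i (suc n) k<m fits apart S covered = E' , joined
    where
    i<i+1+n : i < i + suc n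
    i<i+1+n = subst (i <_) (≡.sym (+-suc i n)) (s≤s (m≤m+n i n))
    i<k : i < k
    i<k = <-≤-trans i<i+1+n fits
    open C4-piece i<k k<m
    disjoint : EdgeDisjoint (graph S) (graph c4)
    disjoint = covers-disjoint {S} {c4} {Done g k i} {Between i k} covered c4-covers
                 (between-fresh i<k (apart i ≤-refl i<i+1+n))
    S₁ = merge S c4 disjoint
    covered₁ : Covers S₁ (Done g k (suc i))
    covered₁ y z e = [ (λ e₀ → done-map ≤-refl (before-weaken (n≤1+n i)) (covered y z e₀))
                     , (λ e₁ → between-done i<k (c4-covers y z e₁)) ]′ (∨-elim _ e)
    rest = c4-row g k (suc i) n k<m (subst (_≤ k) (+-suc i n) fits)
             (λ j i<j j<i+1+n → apart j (<⇒≤ i<j) (subst (j <_) (≡.sym (+-suc i n)) j<i+1+n)) S₁ covered₁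
    E = proj₁ rest
    E' : Extension S (Done g k (i + suc n)) (4 * suc n)
    E' = extension (result E) (subst (λ x → Covers (result E) (Done g k x)) (≡.sym (+-suc i n)) (covers E))
      (begin
        numEdges (graph (result E))          ≡⟨ numEdges-result E ⟩
        numEdges (graph S₁) + 4 * n          ≡⟨ cong (_+ 4 * n) (merge-numEdges S c4 disjoint) ⟩
        numEdges (graph S) + numEdges (graph c4) + 4 * n
                                             ≡⟨ cong (λ x → numEdges (graph S) + x + 4 * n) c4-numEdges ⟩
        numEdges (graph S) + 4 + 4 * n       ≡⟨ +-assoc (numEdges (graph S)) 4 (4 * n) ⟩
        numEdges (graph S) + (4 + 4 * n)     ≡⟨ cong (numEdges (graph S) +_) (*-suc 4 n) ⟨
        numEdges (graph S) + 4 * suc n       ∎)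
      (⊆-trans {S} {S₁} {result E} (⊆-mergeˡ S c4 disjoint) (grows E))
      where open ≡.≡-Reasoning
    first : Joined (result E) i k
    first y z Py Pz = grows E y z (⊆-mergeʳ S c4 disjoint y z (c4-complete y z Py Pz))
    joined : ∀ j → i ≤ j → j < i + suc n → Joined (result E) j k
    joined j i≤j j< = [ (λ i<j → proj₂ rest j i<j (subst (j <_) (+-suc i n) j<))
                      , (λ i≡j → subst (λ x → Joined (result E) x k) i≡j first) ]′ (m≤n⇒m<n∨m≡n i≤j)

  rows : ∀ g (f : ℕ → ℕ) k n → k + n ≤ m →
    (∀ q → k ≤ q → q < k + n → f q ≤ q) →
    (∀ q j → k ≤ q → q < k + n → j < f q → ¬ SameBlock g j q) →
    ∀ S → Covers S (Done g k 0) →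
    Σ (Extension S (Done g (k + n) 0) (4 * sumFrom f k n)) λ E →
      ∀ q j → k ≤ q → q < k + n → j < f q → Joined (result E) j q
  rows g f k zero _ _ _ S covered =
    extension S (subst (λ x → Covers S (Done g x 0)) (≡.sym (+-identityʳ k)) covered)
      (≡.sym (+-identityʳ _)) (λ _ _ e → e) ,
    λ q j k≤q q<k+0 _ → ⊥-elim (<-irrefl refl (<-≤-trans (subst (q <_) (+-identityʳ k) q<k+0) k≤q))
  rows g f k (suc n) fits short apart S covered = E' , joined
    where
    k<k+1+n : k < k + suc n
    k<k+1+n = subst (k <_) (≡.sym (+-suc k n)) (s≤s (m≤m+n k n))
    row = c4-row g k 0 (f k) (<-≤-trans k<k+1+n fits) (short k ≤-refl k<k+1+n)
            (λ j _ j< → apart k j ≤-refl k<k+1+n j<) S covered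
    Row = proj₁ row
    rest = rows g f (suc k) n (subst (_≤ m) (+-suc k n) fits)
             (λ q k<q q< → short q (<⇒≤ k<q) (subst (q <_) (≡.sym (+-suc k n)) q<))
             (λ q j k<q q< → apart q j (<⇒≤ k<q) (subst (q <_) (≡.sym (+-suc k n)) q<))
             (result Row) (λ y z e → done-map ≤-refl before-next-row (covers Row y z e))
    E = proj₁ rest
    E' : Extension S (Done g (k + suc n) 0) (4 * sumFrom f k (suc n))
    E' = extension (result E) (subst (λ x → Covers (result E) (Done g x 0)) (≡.sym (+-suc k n)) (covers E))
      (begin
        numEdges (graph (result E))                               ≡⟨ numEdges-result E ⟩
        numEdges (graph (result Row)) + 4 * sumFrom f (suc k) n   ≡⟨ cong (_+ 4 * sumFrom f (suc k) n) (numEdges-result Row) ⟩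
        numEdges (graph S) + 4 * f k + 4 * sumFrom f (suc k) n    ≡⟨ +-assoc (numEdges (graph S)) _ _ ⟩
        numEdges (graph S) + (4 * f k + 4 * sumFrom f (suc k) n)  ≡⟨ cong (numEdges (graph S) +_) (*-distribˡ-+ 4 (f k) _) ⟨
        numEdges (graph S) + 4 * sumFrom f k (suc n)              ∎)
      (⊆-trans {S} {result Row} {result E} (grows Row) (grows E))
      where open ≡.≡-Reasoning
    joined-row : ∀ j → j < f k → Joined (result E) j k
    joined-row j j< y z Py Pz = grows E y z (proj₂ row j z≤n j< y z Py Pz)
    joined : ∀ q j → k ≤ q → q < k + suc n → j < f q → Joined (result E) j q
    joined q j k≤q q< j< =
      [ (λ k<q → proj₂ rest q j k<q (subst (q <_) (+-suc k n) q<) j<)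
      , (λ k≡q → subst (Joined (result E) j) k≡q (joined-row j (subst (λ x → j < f x) (≡.sym k≡q) j<))) ]′
      (m≤n⇒m<n∨m≡n k≤q)

  block : ∀ h → 4 * h + 4 ≤ m → ∀ S → Covers S (Done h (4 * h) 0) →
    Σ (Extension S (Done (suc h) (4 * h + 4) 0) (28 + 64 * h)) λ E →
      ∀ q → InBlock h q → 0 < q → Joined (result E) 0 q
  block h fits S covered = E' , joined
    where
    open K8-piece {h} fits
    disjoint : EdgeDisjoint (graph S) (graph k8)
    disjoint = covers-disjoint {S} {k8} {Done h (4 * h) 0} {λ p q → InBlock h p × InBlock h q}
                 covered k8-covers block-fresh
    S₁ = merge S k8 disjoint
    covered₁ : Covers S₁ (Done (suc h) (4 * h) 0)
    covered₁ y z e = [ (λ e₀ → done-map (n≤1+n h) (λ b → b) (covered y z e₀))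
                     , (λ e₁ → inj₁ (h , ≤-refl , k8-covers y z e₁)) ]′ (∨-elim _ e)
    other-block : ∀ q j → 4 * h ≤ q → q < 4 * h + 4 → j < 4 * h → ¬ SameBlock (suc h) j q
    other-block q j 4h≤q q< j< (h' , _ , (4h'≤j , _) , bq) =
      <-irrefl refl (<-≤-trans j< (subst (λ x → 4 * x ≤ j) (block-unique {h'} {h} bq (4h≤q , q<)) 4h'≤j))
    rest = rows (suc h) (λ _ → 4 * h) (4 * h) 4 fits (λ q 4h≤q _ → 4h≤q) other-block S₁ covered₁
    E = proj₁ rest
    E' : Extension S (Done (suc h) (4 * h + 4) 0) (28 + 64 * h)
    E' = extension (result E) (covers E)
      (begin
        numEdges (graph (result E))                                          ≡⟨ numEdges-result E ⟩
        numEdges (graph S₁) + 4 * sumFrom (λ _ → 4 * h) (4 * h) 4            ≡⟨ cong₂ _+_ (trans (merge-numEdges S k8 disjoint) (cong (numEdges (graph S) +_) k8-numEdges)) (block-rows h) ⟩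
        numEdges (graph S) + 28 + 64 * h                                     ≡⟨ +-assoc (numEdges (graph S)) 28 (64 * h) ⟩
        numEdges (graph S) + (28 + 64 * h)                                   ∎)
      (⊆-trans {S} {S₁} {result E} (⊆-mergeˡ S k8 disjoint) (grows E))
      where
      open ≡.≡-Reasoning
      block-rows : ∀ h → 4 * (4 * h + (4 * h + (4 * h + (4 * h + 0)))) ≡ 64 * h
      block-rows = solve-∀
    joined : ∀ q → InBlock h q → 0 < q → Joined (result E) 0 q
    joined q bq 0<q y z Py Pz = [ first-block , later-block ]′ (zero-or-positive h)
      where
      first-block : h ≡ 0 → Adj (graph (result E)) y z ≡ true
      first-block h≡0 = grows E y z (⊆-mergeʳ S k8 disjoint y z (k8-complete y z
        (subst (InBlock h) (≡.sym Py) (subst (λ x → InBlock x 0) (≡.sym h≡0) (z≤n , s≤s z≤n)))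
        (subst (InBlock h) (≡.sym Pz) bq)
        λ y≡z → <-irrefl (trans (≡.sym Py) (trans (cong P y≡z) Pz)) 0<q))
      later-block : 0 < h → Adj (graph (result E)) y z ≡ true
      later-block 0<h = proj₂ rest q 0 (proj₁ bq) (proj₂ bq) (*-monoʳ-< 4 0<h) y z Py Pz

  Hub : MarkedGraph → ℕ → Set
  Hub S n = ∀ q → 0 < q → q < n → Joined S 0 q

  blocks : ∀ g → 4 * g ≤ m →
    Σ (Extension empty (Done g (4 * g) 0) (4 * Tri (4 * g) + 4 * g)) λ E → Hub (result E) (4 * g)
  blocks zero _ = extension empty (λ _ _ ()) (≡.sym (+-identityʳ _)) (λ _ _ e → e) , λ _ _ ()
  blocks (suc g) fits = E' , hub
    where
    fits' : 4 * g + 4 ≤ m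
    fits' = subst (_≤ m) (4*suc g) fits
    prev = blocks g (≤-trans (m≤m+n (4 * g) 4) fits')
    E = proj₁ prev
    B = block g fits' (result E) (covers E)
    E' : Extension empty (Done (suc g) (4 * suc g) 0) (4 * Tri (4 * suc g) + 4 * suc g)
    E' = extension (result (proj₁ B))
      (subst (λ x → Covers (result (proj₁ B)) (Done (suc g) x 0)) (≡.sym (4*suc g)) (covers (proj₁ B)))
      (begin
        numEdges (graph (result (proj₁ B)))                          ≡⟨ numEdges-result (proj₁ B) ⟩
        numEdges (graph (result E)) + (28 + 64 * g)                  ≡⟨ cong (_+ (28 + 64 * g)) (numEdges-result E) ⟩
        e₀ + (4 * Tri (4 * g) + 4 * g) + (28 + 64 * g)               ≡⟨ grow e₀ (Tri (4 * g)) g ⟩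
        e₀ + (4 * (Tri (4 * g) + 6 + 4 * g * 4) + 4 * suc g)         ≡⟨ cong (λ t → e₀ + (4 * t + 4 * suc g)) (≡.sym (Tri-+ (4 * g) 4)) ⟩
        e₀ + (4 * Tri (4 * g + 4) + 4 * suc g)                       ≡⟨ cong (λ x → e₀ + (4 * Tri x + 4 * suc g)) (≡.sym (4*suc g)) ⟩
        e₀ + (4 * Tri (4 * suc g) + 4 * suc g)                       ∎)
      (λ _ _ ())
      where
      open ≡.≡-Reasoning
      e₀ = numEdges (graph empty)
      grow : ∀ e t g → e + (4 * t + 4 * g) + (28 + 64 * g) ≡ e + (4 * (t + 6 + 4 * g * 4) + 4 * suc g)
      grow = solve-∀
    hub : Hub (result E') (4 * suc g)
    hub q 0<q q< y z Py Pz =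
      [ (λ q<4g → grows (proj₁ B) y z (proj₂ prev q 0<q q<4g y z Py Pz))
      , (λ q-in → proj₂ B q q-in 0<q y z Py Pz) ]′ (below-or-in-block g q q<)

  with-blocks : ∀ g → 4 * g ≤ m →
    Σ MarkedGraph λ S → numEdges (graph S) ≡ 4 * Tri m + 4 * g × Hub S m
  with-blocks g fits = result E , edge-count , hub
    where
    B = blocks g fits
    beyond-blocks : ∀ q j → 4 * g ≤ q → q < 4 * g + (m ∸ 4 * g) → j < q → ¬ SameBlock g j q
    beyond-blocks q j 4g≤q _ _ (h , h<g , _ , (_ , q<)) =
      <-irrefl refl (<-≤-trans q< (≤-trans (subst (_≤ 4 * g) (4*suc h) (*-monoʳ-≤ 4 h<g)) 4g≤q))
    rest = rows g (λ q → q) (4 * g) (m ∸ 4 * g) (≤-reflexive (m+[n∸m]≡n fits)) (λ _ _ _ → ≤-refl)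
             beyond-blocks (result (proj₁ B)) (covers (proj₁ B))
    E = proj₁ rest
    edge-count : numEdges (graph (result E)) ≡ 4 * Tri m + 4 * g
    edge-count = begin
      numEdges (graph (result E))                                            ≡⟨ numEdges-result E ⟩
      numEdges (graph (result (proj₁ B))) + 4 * sumFrom (λ q → q) (4 * g) n  ≡⟨ cong (_+ 4 * sumFrom (λ q → q) (4 * g) n) (trans (numEdges-result (proj₁ B)) (cong (_+ (4 * Tri (4 * g) + 4 * g)) (numEdges-∅ {m + m}))) ⟩
      4 * Tri (4 * g) + 4 * g + 4 * sumFrom (λ q → q) (4 * g) n              ≡⟨ collect (Tri (4 * g)) g (sumFrom (λ q → q) (4 * g) n) ⟩
      4 * (sumFrom (λ q → q) (4 * g) n + Tri (4 * g)) + 4 * g                ≡⟨ cong (λ t → 4 * t + 4 * g) (trans (sumFrom-id (4 * g) n) (cong Tri (m+[n∸m]≡n fits))) ⟩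
      4 * Tri m + 4 * g                                                      ∎
      where
      open ≡.≡-Reasoning
      n = m ∸ 4 * g
      collect : ∀ t g s → 4 * t + 4 * g + 4 * s ≡ 4 * (s + t) + 4 * g
      collect = solve-∀
    hub : Hub (result E) m
    hub q 0<q q<m y z Py Pz =
      [ (λ q<4g → grows E y z (proj₂ B q 0<q q<4g y z Py Pz))
      , (λ 4g≤q → proj₂ rest q 0 4g≤q (subst (q <_) (≡.sym (m+[n∸m]≡n fits)) q<m) 0<q y z Py Pz) ]′
      (<-or-≥ q (4 * g))

  without-blocks : ∀ k s → suc k ≡ m → s < k →
    Σ MarkedGraph λ S → numEdges (graph S) + 4 * s ≡ 4 * Tri m × Hub S m
  without-blocks k s 1+k≡m s<k = result Last , edge-count , hub
    where
    no-blocks : ∀ {j q} → ¬ SameBlock 0 j q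
    no-blocks (_ , () , _)
    k<m : k < m
    k<m = subst (k <_) 1+k≡m ≤-refl
    earlier = rows 0 (λ q → q) 0 k (<⇒≤ k<m) (λ _ _ _ → ≤-refl) (λ _ _ _ _ _ → no-blocks) empty (λ _ _ ())
    E = proj₁ earlier
    last = c4-row 0 k 0 (k ∸ s) k<m (m∸n≤m k s) (λ _ _ _ → no-blocks) (result E) (covers E)
    Last = proj₁ last
    edge-count : numEdges (graph (result Last)) + 4 * s ≡ 4 * Tri m
    edge-count = begin
      numEdges (graph (result Last)) + 4 * s                                 ≡⟨ cong (_+ 4 * s) (numEdges-result Last) ⟩
      numEdges (graph (result E)) + 4 * (k ∸ s) + 4 * s                      ≡⟨ cong (λ x → x + 4 * (k ∸ s) + 4 * s) (trans (numEdges-result E) (cong (_+ 4 * sumFrom (λ q → q) 0 k) (numEdges-∅ {m + m}))) ⟩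
      4 * sumFrom (λ q → q) 0 k + 4 * (k ∸ s) + 4 * s                        ≡⟨ collect (sumFrom (λ q → q) 0 k) (k ∸ s) s ⟩
      4 * (sumFrom (λ q → q) 0 k + 0) + 4 * (k ∸ s + s)                      ≡⟨ cong₂ (λ x y → 4 * x + 4 * y) (sumFrom-id 0 k) (m∸n+n≡m (<⇒≤ s<k)) ⟩
      4 * Tri k + 4 * k                                                      ≡⟨ *-distribˡ-+ 4 (Tri k) k ⟨
      4 * Tri (suc k)                                                        ≡⟨ cong (λ x → 4 * Tri x) 1+k≡m ⟩
      4 * Tri m                                                              ∎
      where
      open ≡.≡-Reasoning
      collect : ∀ a b c → 4 * a + 4 * b + 4 * c ≡ 4 * (a + 0) + 4 * (b + c)
      collect = solve-∀
    hub : Hub (result Last) m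
    hub q 0<q q<m y z Py Pz =
      [ (λ q<k → grows Last y z (proj₂ earlier q 0 z≤n q<k 0<q y z Py Pz))
      , (λ k≤q → proj₂ last 0 ≤-refl (m<n⇒0<n∸m s<k) y z Py
                   (trans Pz (≤-antisym (s≤s⁻¹ (subst (q <_) (≡.sym 1+k≡m) q<m)) k≤q))) ]′
      (<-or-≥ q k)

module Connectivity (m : ℕ) where
  open Layout m
  open Assembly m

  hub-connected : ∀ S → Hub S m → 2 ≤ m → Connected (graph S)
  hub-connected S hub 2≤m u w = walk-++ (to-hub u) (walk-reverse (to-hub w))
    where
    first second : Fin m
    first  = fromℕ< (<-≤-trans (s≤s z≤n) 2≤m)
    second = fromℕ< 2≤m
    P-first : P (L first) ≡ 0
    P-first = trans (cong toℕ (index-L first)) (toℕ-fromℕ< _)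
    P-second : P (L second) ≡ 1
    P-second = trans (cong toℕ (index-L second)) (toℕ-fromℕ< 2≤m)
    to-hub : ∀ u → Walk (graph S) u (L first)
    to-hub u = [ (λ P≡0 → step (hub 1 (s≤s z≤n) 2≤m u (L second) P≡0 P-second)
                               (step (trans (sym (graph S) (L second) (L first))
                                            (hub 1 (s≤s z≤n) 2≤m (L first) (L second) P-first P-second)) here))
               , (λ 0<P → step (trans (sym (graph S) u (L first))
                                      (hub (P u) 0<P (toℕ<n (index u)) (L first) u P-first refl)) here) ]′
               (zero-or-positive (P u))

  hub-embedding : ∀ S → Hub S m → 2 ≤ m → OrientableQuadEmbedding (graph S)
  hub-embedding S hub 2≤m =
    hub-connected S hub 2≤m , ρ , (ρ-closed , ρ-transitive) , quadrangular
    where open MarkedQuad (marked S)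

Tri-double : ∀ m → Tri (m + m) ≡ 4 * Tri m + m
Tri-double m = begin
  Tri (m + m)                          ≡⟨ Tri-+ m m ⟩
  Tri m + Tri m + m * m                ≡⟨ cong (Tri m + Tri m +_) (square m) ⟩
  Tri m + Tri m + (Tri m + Tri m + m)  ≡⟨ collect (Tri m) m ⟩
  4 * Tri m + m                        ∎
  where
  open ≡.≡-Reasoning
  collect : ∀ t m → t + t + (t + t + m) ≡ 4 * t + m
  collect = solve-∀
  square : ∀ m → m * m ≡ Tri m + Tri m + m
  square zero    = refl
  square (suc m) = begin
    suc m * suc m                      ≡⟨ expand m ⟩
    m * m + (1 + m + m)                ≡⟨ cong (_+ (1 + m + m)) (square m) ⟩
    Tri m + Tri m + m + (1 + m + m)    ≡⟨ regroup (Tri m) m ⟩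
    Tri m + m + (Tri m + m) + suc m    ∎
    where
    expand : ∀ m → suc m * suc m ≡ m * m + (1 + m + m)
    expand = solve-∀
    regroup : ∀ t m → t + t + m + (1 + m + m) ≡ t + m + (t + m) + suc m
    regroup = solve-∀

same-residue : ∀ m t → (2 * t + 5 * (m + m)) % 8 ≡ ((m + m) * (m + m)) % 8 → t % 4 ≡ m % 4
same-residue m t congruent = residues (m%n<n m 4) (m%n<n t 4) reduced
  where
  open ≡.≡-Reasoning
  r = m % 4
  q = m / 4
  r' = t % 4
  j = t / 4
  expand-left : ∀ r q r' j → 2 * (r' + j * 4) + 5 * ((r + q * 4) + (r + q * 4)) ≡ (2 * r' + 10 * r) + (j + 5 * q) * 8
  expand-left = solve-∀
  expand-right : ∀ r q → (r + q * 4 + (r + q * 4)) * (r + q * 4 + (r + q * 4)) ≡ 4 * r * r + (8 * q * q + 4 * q * r) * 8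
  expand-right = solve-∀
  reduced : (2 * r' + 10 * r) % 8 ≡ (4 * r * r) % 8
  reduced = begin
    (2 * r' + 10 * r) % 8                            ≡⟨ [m+kn]%n≡m%n (2 * r' + 10 * r) (j + 5 * q) 8 ⟨
    ((2 * r' + 10 * r) + (j + 5 * q) * 8) % 8        ≡⟨ cong (_% 8) (expand-left r q r' j) ⟨
    (2 * (r' + j * 4) + 5 * ((r + q * 4) + (r + q * 4))) % 8
      ≡⟨ cong₂ (λ a b → (2 * a + 5 * (b + b)) % 8) (m≡m%n+[m/n]*n t 4) (m≡m%n+[m/n]*n m 4) ⟨
    (2 * t + 5 * (m + m)) % 8                        ≡⟨ congruent ⟩
    ((m + m) * (m + m)) % 8                          ≡⟨ cong (λ a → ((a + a) * (a + a)) % 8) (m≡m%n+[m/n]*n m 4) ⟩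
    ((r + q * 4 + (r + q * 4)) * (r + q * 4 + (r + q * 4))) % 8 ≡⟨ cong (_% 8) (expand-right r q) ⟩
    (4 * r * r + (8 * q * q + 4 * q * r) * 8) % 8    ≡⟨ [m+kn]%n≡m%n (4 * r * r) (8 * q * q + 4 * q * r) 8 ⟩
    (4 * r * r) % 8                                  ∎
  residues : ∀ {r r'} (r<4 : r < 4) (r'<4 : r' < 4) → (2 * r' + 10 * r) % 8 ≡ (4 * r * r) % 8 → r' ≡ r
  residues r<4 r'<4 = subst₂ (λ a b → (2 * b + 10 * a) % 8 ≡ (4 * a * a) % 8 → b ≡ a)
    (toℕ-fromℕ< r<4) (toℕ-fromℕ< r'<4)
    (toWitness {a? = all? λ (a : Fin 4) → all? λ (b : Fin 4) →
       ((2 * toℕ b + 10 * toℕ a) % 8 ≟ℕ (4 * toℕ a * toℕ a) % 8) →-dec (toℕ b ≟ℕ toℕ a)} tt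
       (fromℕ< r<4) (fromℕ< r'<4))

data Parameters (m t : ℕ) : Set where
  k8-blocks   : ∀ g → 4 * g ≤ m → t + 4 * g ≡ m → Parameters m t
  missing-c4s : ∀ s → s + 2 ≤ m → t ≡ m + 4 * s → Parameters m t

blocks-parameters : ∀ r j d → Parameters (r + (j + d) * 4) (r + j * 4)
blocks-parameters r j d =
  k8-blocks d (subst (4 * d ≤_) (regroup₁ r j d) (m≤m+n (4 * d) (r + 4 * j))) (regroup₂ r j d)
  where
  regroup₁ : ∀ r j d → 4 * d + (r + 4 * j) ≡ r + (j + d) * 4
  regroup₁ = solve-∀
  regroup₂ : ∀ r j d → r + j * 4 + 4 * d ≡ r + (j + d) * 4
  regroup₂ = solve-∀

gaps-parameters : ∀ r q d → r + (suc q + d) * 4 + 4 ≤ (r + q * 4) + (r + q * 4) →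
  Parameters (r + q * 4) (r + (suc q + d) * 4)
gaps-parameters r q d bound = missing-c4s (suc d) (≤-trans (subst (suc d + 2 ≤_) (spread d) (m≤m+n _ (3 * d + 5)))
  (+-cancelˡ-≤ (r + q * 4) _ _ (subst (_≤ (r + q * 4) + (r + q * 4)) (regroup₁ r q d) bound)))
  (regroup₂ r q d)
  where
  spread : ∀ d → suc d + 2 + (3 * d + 5) ≡ 4 * suc d + 4
  spread = solve-∀
  regroup₁ : ∀ r q d → r + (suc q + d) * 4 + 4 ≡ r + q * 4 + (4 * suc d + 4)
  regroup₁ = solve-∀
  regroup₂ : ∀ r q d → r + (suc q + d) * 4 ≡ r + q * 4 + 4 * suc d
  regroup₂ = solve-∀

parameters : ∀ m t → t + 4 ≤ m + m → t % 4 ≡ m % 4 → Parameters m t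
parameters m t bound residue with t / 4 ≤? m / 4
... | yes j≤q with m≤n⇒∃[o]m+o≡n j≤q
...   | d , j+d≡q = subst₂ Parameters (≡.sym m≡) (≡.sym t≡) (blocks-parameters (m % 4) (t / 4) d)
  where
  m≡ : m ≡ m % 4 + (t / 4 + d) * 4
  m≡ = trans (m≡m%n+[m/n]*n m 4) (cong (λ q → m % 4 + q * 4) (≡.sym j+d≡q))
  t≡ : t ≡ m % 4 + t / 4 * 4
  t≡ = trans (m≡m%n+[m/n]*n t 4) (cong (_+ t / 4 * 4) residue)
parameters m t bound residue | no j≰q with m≤n⇒∃[o]m+o≡n (≰⇒> j≰q)
... | d , 1+q+d≡j = subst₂ Parameters (≡.sym m≡) (≡.sym t≡) (gaps-parameters (m % 4) (m / 4) d
                      (subst₂ (λ a b → b + 4 ≤ a + a) m≡ t≡ bound))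
  where
  m≡ : m ≡ m % 4 + m / 4 * 4
  m≡ = m≡m%n+[m/n]*n m 4
  t≡ : t ≡ m % 4 + (suc (m / 4) + d) * 4
  t≡ = trans (m≡m%n+[m/n]*n t 4) (cong₂ (λ r j → r + j * 4) residue (≡.sym 1+q+d≡j))

even-case : ∀ m t → 2 ≤ m → t + 4 ≤ m + m → t % 4 ≡ m % 4 →
  Σ (SimpleGraph (m + m)) λ G → numEdges G + t ≡ (m + m) C 2 × OrientableQuadEmbedding G
even-case m t 2≤m bound residue with parameters m t bound residue
... | k8-blocks g fits t+4g≡m =
  let (S , edges , hub) = Assembly.with-blocks m g fits in
  Layout.graph S , edge-count S edges , Connectivity.hub-embedding m S hub 2≤m
  where
  open ≡.≡-Reasoning
  edge-count : ∀ S → numEdges (Layout.graph S) ≡ 4 * Tri m + 4 * g → numEdges (Layout.graph S) + t ≡ (m + m) C 2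
  edge-count S edges = begin
    numEdges (Layout.graph S) + t    ≡⟨ cong (_+ t) edges ⟩
    4 * Tri m + 4 * g + t            ≡⟨ regroup (4 * Tri m) (4 * g) t ⟩
    4 * Tri m + (t + 4 * g)          ≡⟨ cong (4 * Tri m +_) t+4g≡m ⟩
    4 * Tri m + m                    ≡⟨ trans (Tri-C (m + m)) (Tri-double m) ⟨
    (m + m) C 2                      ∎
    where
    regroup : ∀ a b c → a + b + c ≡ a + (c + b)
    regroup = solve-∀
even-case (suc k) t 2≤m bound residue | missing-c4s s fits t≡m+4s =
  let (S , edges , hub) = Assembly.without-blocks (suc k) k s refl s<k in
  Layout.graph S , edge-count S edges , Connectivity.hub-embedding (suc k) S hub 2≤m
  where
  open ≡.≡-Reasoning
  m = suc k
  s<k : s < k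
  s<k = s≤s⁻¹ (subst (_≤ suc k) (+-comm s 2) fits)
  edge-count : ∀ S → numEdges (Layout.graph S) + 4 * s ≡ 4 * Tri m → numEdges (Layout.graph S) + t ≡ (m + m) C 2
  edge-count S edges = begin
    numEdges (Layout.graph S) + t              ≡⟨ cong (numEdges (Layout.graph S) +_) t≡m+4s ⟩
    numEdges (Layout.graph S) + (m + 4 * s)    ≡⟨ regroup (numEdges (Layout.graph S)) m (4 * s) ⟩
    numEdges (Layout.graph S) + 4 * s + m      ≡⟨ cong (_+ m) edges ⟩
    4 * Tri m + m                              ≡⟨ trans (Tri-C (m + m)) (Tri-double m) ⟨
    (m + m) C 2                                ∎
    where
    regroup : ∀ a b c → a + (b + c) ≡ a + c + b
    regroup = solve-∀

C4-embedding : OrientableQuadEmbedding C4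
C4-embedding = Connectivity.hub-embedding 2 (Layout.marked-graph C4 C4-marked) hub (s≤s (s≤s z≤n))
  where
  open Layout 2 using (P)
  hub : Assembly.Hub 2 (Layout.marked-graph C4 C4-marked) 2
  hub (suc zero) _ _ = toWitness {a? = all? λ y → all? λ z →
    (P y ≟ℕ 0) →-dec ((P z ≟ℕ 1) →-dec (Adj C4 y z ≟ᵇ true))} tt
  hub (suc (suc _)) _ (s≤s (s≤s ()))

half : ∀ {n} → 2 ∣ n → Σ ℕ λ m → m + m ≡ n
half (divides m n≡m*2) =
  m , ≡.sym (trans n≡m*2 (trans (*-comm m 2) (cong (m +_) (+-identityʳ m))))

lemma4p1 : (Σ (SimpleGraph 4) λ G → numEdges G ≡ 4 × OrientableQuadEmbedding G) ×
    (∀ (n t : ℕ) → 2 ∣ n → 4 ≤ n → t ≤ n ∸ 4 →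
    (2 * t + 5 * n) % 8 ≡ (n * n) % 8 →
    Σ (SimpleGraph n) λ G → numEdges G + t ≡ n C 2 × OrientableQuadEmbedding G)
lemma4p1 = (C4 , refl , C4-embedding) , even
  where
  even : ∀ (n t : ℕ) → 2 ∣ n → 4 ≤ n → t ≤ n ∸ 4 → (2 * t + 5 * n) % 8 ≡ (n * n) % 8 →
    Σ (SimpleGraph n) λ G → numEdges G + t ≡ n C 2 × OrientableQuadEmbedding G
  even n t 2∣n 4≤n t≤n-4 congruent with half 2∣n
  ... | m , refl = even-case m t (half≥2 m 4≤n) (subst (t + 4 ≤_) (m∸n+n≡m 4≤n) (+-monoˡ-≤ 4 t≤n-4))
                     (same-residue m t congruent)
    where
    half≥2 : ∀ m → 4 ≤ m + m → 2 ≤ m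
    half≥2 (suc (suc m)) _ = s≤s (s≤s z≤n)
    half≥2 (suc zero) (s≤s (s≤s ()))
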